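{- Let $n,p,q$ be positive integers with $n>q$, and let the symmetric group $S_n$ act on the states of $\mathrm{DASEP}(n,p,q)$ by permuting the $n$ sites (i.e. permuting the coordinates of the $n$-tuple). Then, with statistic $\pi_{\mathrm{DASEP}}:\Gamma^{p,q}_n\to\mathbb{Q}[u,t]$, the triple $(\Gamma^{p,q}_n,S_n,\mathbb{Q}[u,t])$ exhibits homomesy in the generalized sense: there is a polynomial $c\in\mathbb{Q}[u,t]$ such that for every $S_n$-orbit $O$ there exist nonnegative integers $e_u^O,e_t^O$ with $$\frac{1}{\#O}\sum_{x\in O}\pi_{\mathrm{DASEP}}(x)=u^{e_u^O}t^{e_t^O}c.$$
   Context: $\mathrm{DASEP}(n,p,q)$ with parameters $t,u$ (treated as formal variables): its state space $\Gamma^{p,q}_n$ is the set of $n$-tuples with entries in $\{0,\dots,p\}$ with exactly $q$ nonzero entries; positions are cyclic (position $n$ followed by $1$). Transition probabilities: swapping entries $a=\mu_k\ne b=\mu_{k+1}$ at cyclically consecutive positions has probability $\frac{1}{3n}$ if $b>a$ and $\frac{t}{3n}$ if $a>b$; changing one entry $i$ ($1\le i\le p-1$) to $i+1$ has probability $\frac{u}{3n}$; changing one entry $i+1$ ($i\ge1$) to $i$ has probability $\frac{1}{3n}$; other off-diagonal probabilities $0$; diagonal makes rows sum to $1$. $\pi_{\mathrm{DASEP}}$ denotes the unnormalized stationary distribution, whose values are polynomials in $u,t$ with greatest common divisor $1$. -}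

module Defs where

open import Data.Bool using (Bool; true; false; if_then_else_; _∧_; not)
open import Data.Nat as ℕ using (ℕ; zero; suc; NonZero)
open import Data.Nat.DivMod using (_%_; m%n<n)
open import Data.Fin as Fin using (Fin; toℕ; fromℕ<)
open import Data.Vec as Vec using (Vec; []; _∷_; lookup; tabulate; _[_]≔_)
open import Data.Vec.Properties using (≡-dec)
open import Data.List as List using (List; []; _∷_; map; concatMap; filter; allFin; foldr; length)
open import Data.Product using (Σ; _×_; _,_)
open import Data.Integer using (+_)
open import Data.Rational as ℚ using (ℚ; 0ℚ; 1ℚ)
open import Relation.Nullary.Decidable using (⌊_⌋; ¬?)
open import Relation.Binary.PropositionalEquality using (_≡_)
open import Data.Fin.Permutation using (Permutation′; _⟨$⟩ʳ_)

-- Polynomials in ℚ[u,t], represented by finite lists of terms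
-- (exponent of u, exponent of t, coefficient).  Equality is equality of
-- all coefficients.

Poly : Set
Poly = List (ℕ × ℕ × ℚ)

coeff : Poly → ℕ → ℕ → ℚ
coeff [] i j = 0ℚ
coeff ((a , b , c) ∷ ps) i j =
  (if ⌊ a ℕ.≟ i ⌋ ∧ ⌊ b ℕ.≟ j ⌋ then c else 0ℚ) ℚ.+ coeff ps i j

infix 4 _≈_
_≈_ : Poly → Poly → Set
p ≈ q = ∀ i j → coeff p i j ≡ coeff q i j

infixl 6 _+P_ _-P_
infixl 7 _*P_

_+P_ : Poly → Poly → Poly
p +P q = p List.++ q

negP : Poly → Poly
negP = map (λ { (a , b , c) → (a , b , ℚ.- c) })

_-P_ : Poly → Poly → Poly
p -P q = p +P negP q

_*P_ : Poly → Poly → Poly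
p *P q = concatMap (λ { (a , b , c) → map (λ { (a' , b' , c') → (a ℕ.+ a' , b ℕ.+ b' , c ℚ.* c') }) q }) p

constℚ : ℚ → Poly
constℚ c = (0 , 0 , c) ∷ []

constℕ : ℕ → Poly
constℕ k = constℚ ((+ k) ℚ./ 1)

0P 1P varU varT : Poly
0P = []
1P = constℚ 1ℚ
varU = (1 , 0 , 1ℚ) ∷ []
varT = (0 , 1 , 1ℚ) ∷ []

monomial : ℕ → ℕ → Poly
monomial a b = (a , b , 1ℚ) ∷ []

_∣P_ : Poly → Poly → Set
d ∣P p = Σ Poly λ e → d *P e ≈ p

IsUnit : Poly → Set
IsUnit d = Σ Poly λ e → d *P e ≈ 1P

sumP : {A : Set} → List A → (A → Poly) → Poly
sumP xs f = foldr (λ x acc → f x +P acc) 0P xs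

Tuple : ℕ → ℕ → Set
Tuple n p = Vec (Fin (suc p)) n

allTuples : (n p : ℕ) → List (Tuple n p)
allTuples zero    p = Vec.[] ∷ []
allTuples (suc n) p = concatMap (λ a → map (a ∷_) (allTuples n p)) (allFin (suc p))

nonzeroCount : ∀ {n p} → Tuple n p → ℕ
nonzeroCount [] = 0
nonzeroCount (Fin.zero ∷ v) = nonzeroCount v
nonzeroCount (Fin.suc _ ∷ v) = suc (nonzeroCount v)

InΓ : ∀ {n p} → ℕ → Tuple n p → Set
InΓ q v = nonzeroCount v ≡ q

Γ : (n p q : ℕ) → List (Tuple n p)
Γ n p q = filter (λ v → nonzeroCount v ℕ.≟ q) (allTuples n p)

next : ∀ {n} → Fin n → Fin n
next {suc m} k = fromℕ< (m%n<n (suc (toℕ k)) (suc m))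

swapAt : ∀ {n p} → Fin n → Tuple n p → Tuple n p
swapAt k μ = (μ [ k ]≔ lookup μ (next k)) [ next k ]≔ lookup μ k

_=V_ : ∀ {n p} → Tuple n p → Tuple n p → Bool
μ =V ν = ⌊ ≡-dec Fin._≟_ μ ν ⌋

swapRate : ∀ {n p} → Fin n → Tuple n p → Tuple n p → Poly
swapRate k μ ν =
  let a = lookup μ k ; b = lookup μ (next k) in
  if not ⌊ a Fin.≟ b ⌋ ∧ (ν =V swapAt k μ)
  then (if ⌊ toℕ a ℕ.<? toℕ b ⌋ then 1P else varT)
  else 0P

changeRate : ∀ {n p} → Fin n → Tuple n p → Tuple n p → Poly
changeRate i μ ν =
  let a = toℕ (lookup μ i) ; b = toℕ (lookup ν i)
      onlyI = ν =V (μ [ i ]≔ lookup ν i) in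
  if onlyI ∧ ⌊ b ℕ.≟ suc a ⌋ ∧ ⌊ 1 ℕ.≤? a ⌋ then varU
  else if onlyI ∧ ⌊ a ℕ.≟ suc b ⌋ ∧ ⌊ 1 ℕ.≤? b ⌋ then 1P
  else 0P

rate : ∀ {n p} → Tuple n p → Tuple n p → Poly
rate {n} μ ν = sumP (allFin n) (λ k → swapRate k μ ν +P changeRate k μ ν)

-- W μ ν = 3n · P(μ,ν) as an element of ℚ[u,t] (diagonal makes rows sum to 3n)
W : (n p q : ℕ) → Tuple n p → Tuple n p → Poly
W n p q μ ν =
  if μ =V ν then constℕ (3 ℕ.* n) -P sumP (Γ n p q) (rate μ) else rate μ ν

IsStationary : (n p q : ℕ) → (Tuple n p → Poly) → Set
IsStationary n p q π =
  ∀ ν → InΓ q ν → sumP (Γ n p q) (λ μ → π μ *P W n p q μ ν) ≈ constℕ (3 ℕ.* n) *P π ν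

GCDOne : (n p q : ℕ) → (Tuple n p → Poly) → Set
GCDOne n p q π = ∀ d → (∀ μ → InΓ q μ → d ∣P π μ) → IsUnit d

act : ∀ {n p} → Permutation′ n → Tuple n p → Tuple n p
act σ x = tabulate (λ i → lookup x (σ ⟨$⟩ʳ i))

InOrbit : ∀ {n p} → Tuple n p → Tuple n p → Set
InOrbit x y = Σ _ λ σ → y ≡ act σ x

{-# OPTIONS --safe #-}
module Submission where

-- The orbits of the coordinate action of S_n are the content classes (states with the
-- same multiset of entries).  Let the level of a state be Σᵢ max(μᵢ − 1, 0), the number of
-- rate-u moves needed to reach it from the unique level-zero class of Γ.  Multiplying the
-- balance equations of π by the indicator of a class x and summing, the swap moves cancel
-- (they preserve content) and only raising moves (rate u, level + 1) and lowering moves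
-- (rate 1, level − 1) remain.  Read off at u^(level x + k) t^b, this determines the class
-- sum of x from class sums at level (level x − 1) with the same k and class sums with
-- k − 1.  Induction on k, and for fixed k on the level, starting from the level-zero class,
-- shows that the sum of π over the class of x is #class · u^(level x) · c, where c is the
-- average of π over level zero.

open import Defs
open import Data.Bool using (Bool; true; false; if_then_else_; _∧_; not)
open import Data.Nat as ℕ using (ℕ; zero; suc; _≤_; _<_)
import Data.Nat.Properties as NP
open import Data.Integer as ℤ using (ℤ; -[1+_])
import Data.Integer.Properties as ZP
open import Data.Rational as Q using (ℚ; 0ℚ; 1ℚ; mkℚ; _+_; _*_; -_; _-_)
import Data.Rational.Properties as QP
open import Data.Rational.Solver
open import Data.List as List using (List; []; _∷_; _++_; map; concatMap; filter; length)
open import Data.List.Membership.Propositional using (_∈_)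
open import Data.List.Relation.Unary.Any using (here; there)
open import Data.List.Relation.Unary.Unique.Propositional using (Unique)
import Data.List.Relation.Unary.AllPairs as AP
import Data.List.Relation.Unary.All as All
open import Data.Vec using (Vec; []; _∷_; lookup; tabulate; _[_]≔_; removeAt; insertAt)
import Data.Vec.Properties as VP
open import Data.Vec.Properties using (≡-dec)
open import Data.Fin as Fin using (Fin; toℕ)
import Data.Fin.Properties as FP
open import Data.Fin.Permutation as Perm using (Permutation′; _⟨$⟩ʳ_; _⟨$⟩ˡ_)
open import Relation.Binary.PropositionalEquality
open import Relation.Unary using (Decidable)
open import Relation.Nullary using (yes; no; ¬_; Dec)
open import Relation.Nullary.Decidable using (⌊_⌋)
open import Data.Product using (Σ; Σ-syntax; _×_; _,_; proj₁; proj₂)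
open import Data.Sum using (_⊎_; inj₁; inj₂)
open import Data.Empty using (⊥; ⊥-elim)
import Data.Nat.Coprimality as C
open import Data.Rational.Unnormalised using (*≡*)
import Data.Rational.Unnormalised.Properties as UP
open import Function.Bundles using (_⇔_; Equivalence)
open import Function.Base using (_∘_; case_of_)
open +-*-Solver
import Data.Nat.Solver
module NS = Data.Nat.Solver.+-*-Solver
import Data.Integer.Solver
module ZS = Data.Integer.Solver.+-*-Solver

x-y+z≡x⇒z≡y : (x y z : ℚ) → x - y + z ≡ x → z ≡ y
x-y+z≡x⇒z≡y x y z h = begin
    z                     ≡⟨ solve 3 (λ x y z → z := (x :- y :+ z) :+ (y :- x)) refl x y z ⟩
    (x - y + z) + (y - x) ≡⟨ cong (_+ (y - x)) h ⟩
    x + (y - x)           ≡⟨ solve 2 (λ x y → x :+ (y :- x) := y) refl x y ⟩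
    y                     ∎
  where open ≡-Reasoning

x-y≡0⇒y≡x : (x y : ℚ) → x - y ≡ 0ℚ → y ≡ x
x-y≡0⇒y≡x x y h = begin
    y           ≡⟨ solve 2 (λ x y → y := x :- (x :- y)) refl x y ⟩
    x - (x - y) ≡⟨ cong (λ w → x - w) h ⟩
    x - 0ℚ      ≡⟨ solve 1 (λ x → x :- con 0ℚ := x) refl x ⟩
    x           ∎
  where open ≡-Reasoning

inv : ℚ → ℚ
inv x with x Q.≟ 0ℚ
... | yes _ = 0ℚ
... | no ne = Q.1/_ x {{Q.≢-nonZero ne}}

inv-inverseˡ : (x : ℚ) → ¬ (x ≡ 0ℚ) → inv x * x ≡ 1ℚ
inv-inverseˡ x ne with x Q.≟ 0ℚ
... | yes e = ⊥-elim (ne e)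
... | no ne2 = QP.*-inverseˡ x {{Q.≢-nonZero ne2}}

*-cancel-≢0 : (x y : ℚ) → ¬ (x ≡ 0ℚ) → x * y ≡ 0ℚ → y ≡ 0ℚ
*-cancel-≢0 x y ne h = begin
    y ≡⟨ sym (QP.*-identityˡ y) ⟩
    1ℚ * y ≡⟨ cong (_* y) (sym (inv-inverseˡ x ne)) ⟩
    inv x * x * y ≡⟨ QP.*-assoc (inv x) x y ⟩
    inv x * (x * y) ≡⟨ cong (inv x *_) h ⟩
    inv x * 0ℚ ≡⟨ QP.*-zeroʳ (inv x) ⟩
    0ℚ ∎
  where open ≡-Reasoning

χ : Bool → ℚ
χ true = 1ℚ
χ false = 0ℚ

∑ : {A : Set} → List A → (A → ℚ) → ℚ
∑ [] f = 0ℚ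
∑ (x ∷ xs) f = f x + ∑ xs f

module _ {A : Set} where
  ∑-cong-∈ : (L : List A) {f g : A → ℚ} → (∀ x → x ∈ L → f x ≡ g x) → ∑ L f ≡ ∑ L g
  ∑-cong-∈ [] h = refl
  ∑-cong-∈ (x ∷ L) h = cong₂ _+_ (h x (here refl)) (∑-cong-∈ L (λ y y∈ → h y (there y∈)))

  ∑-cong : (L : List A) {f g : A → ℚ} → (∀ x → f x ≡ g x) → ∑ L f ≡ ∑ L g
  ∑-cong L h = ∑-cong-∈ L (λ x _ → h x)

  ∑-+ : (L : List A) (f g : A → ℚ) → ∑ L (λ x → f x + g x) ≡ ∑ L f + ∑ L g
  ∑-+ [] f g = refl
  ∑-+ (x ∷ L) f g rewrite ∑-+ L f g =
    solve 4 (λ a b c d → (a :+ b) :+ (c :+ d) := (a :+ c) :+ (b :+ d)) refl (f x) (g x) (∑ L f) (∑ L g)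

  ∑-*ˡ : (L : List A) (c : ℚ) (f : A → ℚ) → ∑ L (λ x → c * f x) ≡ c * ∑ L f
  ∑-*ˡ [] c f = sym (QP.*-zeroʳ c)
  ∑-*ˡ (x ∷ L) c f rewrite ∑-*ˡ L c f = sym (QP.*-distribˡ-+ c (f x) (∑ L f))

  ∑-*ʳ : (L : List A) (c : ℚ) (f : A → ℚ) → ∑ L (λ x → f x * c) ≡ ∑ L f * c
  ∑-*ʳ L c f = trans (∑-cong L (λ x → QP.*-comm (f x) c)) (trans (∑-*ˡ L c f) (QP.*-comm c (∑ L f)))

  ∑-neg : (L : List A) (f : A → ℚ) → ∑ L (λ x → - f x) ≡ - ∑ L f
  ∑-neg [] f = refl
  ∑-neg (x ∷ L) f rewrite ∑-neg L f = sym (QP.neg-distrib-+ (f x) (∑ L f))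

  ∑-sub : (L : List A) (f g : A → ℚ) → ∑ L (λ x → f x - g x) ≡ ∑ L f - ∑ L g
  ∑-sub L f g = trans (∑-+ L f (λ x → - g x)) (cong (∑ L f +_) (∑-neg L g))

  ∑-zero : (L : List A) (f : A → ℚ) → (∀ x → x ∈ L → f x ≡ 0ℚ) → ∑ L f ≡ 0ℚ
  ∑-zero [] f h = refl
  ∑-zero (x ∷ L) f h rewrite h x (here refl) | ∑-zero L f (λ y y∈ → h y (there y∈)) = refl

  ∑-++ : (L M : List A) (f : A → ℚ) → ∑ (L ++ M) f ≡ ∑ L f + ∑ M f
  ∑-++ [] M f = sym (QP.+-identityˡ _)
  ∑-++ (x ∷ L) M f rewrite ∑-++ L M f = sym (QP.+-assoc (f x) (∑ L f) (∑ M f))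

  ∑-filter : (L : List A) {P : A → Set} (P? : Decidable P) (f : A → ℚ) →
             ∑ (filter P? L) f ≡ ∑ L (λ x → χ (⌊ P? x ⌋) * f x)
  ∑-filter [] P? f = refl
  ∑-filter (x ∷ L) P? f with P? x
  ... | yes _ rewrite ∑-filter L P? f | QP.*-identityˡ (f x) = refl
  ... | no _ rewrite ∑-filter L P? f | QP.*-zeroˡ (f x) = sym (QP.+-identityˡ _)

∑-map : {A B : Set} (g : A → B) (L : List A) (f : B → ℚ) → ∑ (map g L) f ≡ ∑ L (λ x → f (g x))
∑-map g [] f = refl
∑-map g (x ∷ L) f rewrite ∑-map g L f = refl

∑-concatMap : {A B : Set} (g : A → List B) (L : List A) (f : B → ℚ) → ∑ (concatMap g L) f ≡ ∑ L (λ x → ∑ (g x) f)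
∑-concatMap g [] f = refl
∑-concatMap g (x ∷ L) f rewrite ∑-++ (g x) (concatMap g L) f | ∑-concatMap g L f = refl

∑-comm : {A B : Set} (L : List A) (M : List B) (f : A → B → ℚ) →
         ∑ L (λ x → ∑ M (λ y → f x y)) ≡ ∑ M (λ y → ∑ L (λ x → f x y))
∑-comm [] M f = sym (∑-zero M (λ _ → 0ℚ) (λ _ _ → refl))
∑-comm (x ∷ L) M f rewrite ∑-comm L M f = sym (∑-+ M (f x) (λ y → ∑ L (λ x₁ → f x₁ y)))

χ-∧ : (a b : Bool) → χ (a ∧ b) ≡ χ a * χ b
χ-∧ true b = sym (QP.*-identityˡ (χ b))
χ-∧ false b = sym (QP.*-zeroˡ (χ b))

χ-not : (a : Bool) → χ (not a) ≡ 1ℚ - χ a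
χ-not true = refl
χ-not false = refl

χ∧χ-transport : (b1 b2 : Bool) (X Y : ℚ) → (b1 ≡ true → b2 ≡ true → X ≡ Y) → X * (χ b1 * χ b2) ≡ (χ b1 * χ b2) * Y
χ∧χ-transport true true X Y h = trans (QP.*-comm X _) (cong ((χ true * χ true) *_) (h refl refl))
χ∧χ-transport true false X Y h = trans (QP.*-zeroʳ X) (sym (QP.*-zeroˡ Y))
χ∧χ-transport false true X Y h = trans (QP.*-zeroʳ X) (sym (QP.*-zeroˡ Y))
χ∧χ-transport false false X Y h = trans (QP.*-zeroʳ X) (sym (QP.*-zeroˡ Y))

χ-transport : (b1 : Bool) (X Y U V : ℚ) → (b1 ≡ true → (X ≡ Y) × (U ≡ V)) → X * (χ b1 * U) ≡ V * (χ b1 * Y)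
χ-transport true X Y U V h = trans (cong₂ (λ s t → s * (1ℚ * t)) (proj₁ (h refl)) (proj₂ (h refl)))
   (solve 2 (λ y v → y :* (con 1ℚ :* v) := v :* (con 1ℚ :* y)) refl Y V)
χ-transport false X Y U V h = trans (cong (X *_) (QP.*-zeroˡ U)) (trans (QP.*-zeroʳ X) (sym (trans (cong (V *_) (QP.*-zeroˡ Y)) (QP.*-zeroʳ V))))

⌊⌋-true⇒ : {P : Set} (d : Dec P) → ⌊ d ⌋ ≡ true → P
⌊⌋-true⇒ (yes x) _ = x
⌊⌋-true⇒ (no _) ()

⌊⌋-true⇐ : {P : Set} (d : Dec P) → P → ⌊ d ⌋ ≡ true
⌊⌋-true⇐ (yes _) _ = refl
⌊⌋-true⇐ (no ¬p) x = ⊥-elim (¬p x)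

∧-l : (a : Bool) {b : Bool} → a ∧ b ≡ true → a ≡ true
∧-l true _ = refl
∧-r : (a : Bool) {b : Bool} → a ∧ b ≡ true → b ≡ true
∧-r true e = e
∧-i : {a b : Bool} → a ≡ true → b ≡ true → a ∧ b ≡ true
∧-i refl refl = refl

Bool-ext : {a b : Bool} → (a ≡ true → b ≡ true) → (b ≡ true → a ≡ true) → a ≡ b
Bool-ext {true} {true} f g = refl
Bool-ext {true} {false} f g = sym (f refl)
Bool-ext {false} {true} f g = g refl
Bool-ext {false} {false} f g = refl

fromℕ : ℕ → ℚ
fromℕ k = mkℚ (ℤ.+ k) 0 (C.sym (C.1-coprimeTo k))

/1≡fromℕ : (k : ℕ) → (ℤ.+ k) Q./ 1 ≡ fromℕ k
/1≡fromℕ k = QP.normalize-coprime {k} {0} (C.sym (C.1-coprimeTo k))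

fromℕ-suc : (k : ℕ) → fromℕ (suc k) ≡ 1ℚ + fromℕ k
fromℕ-suc k = sym (QP.toℚᵘ-injective (UP.≃-trans (QP.toℚᵘ-homo-+ 1ℚ (fromℕ k)) (*≡* eq)))
  where
  eq : (ℤ.+ 1 ℤ.* ℤ.+ 1 ℤ.+ ℤ.+ k ℤ.* ℤ.+ 1) ℤ.* ℤ.+ 1 ≡ ℤ.+ (suc k) ℤ.* (ℤ.+ (1 ℕ.* 1))
  eq rewrite ZP.*-identityʳ (ℤ.+ 1 ℤ.* ℤ.+ 1 ℤ.+ ℤ.+ k ℤ.* ℤ.+ 1) | ZP.*-identityʳ (ℤ.+ k) | ZP.*-identityʳ (ℤ.+ (suc k)) = refl

fromℕ-+ : (a b : ℕ) → fromℕ (a ℕ.+ b) ≡ fromℕ a + fromℕ b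
fromℕ-+ zero b = sym (QP.+-identityˡ _)
fromℕ-+ (suc a) b = trans (fromℕ-suc (a ℕ.+ b)) (trans (cong (1ℚ +_) (fromℕ-+ a b)) (trans (sym (QP.+-assoc 1ℚ (fromℕ a) (fromℕ b))) (cong
    (_+ fromℕ b) (sym (fromℕ-suc a)))))

fromℕ-injective : {a b : ℕ} → fromℕ a ≡ fromℕ b → a ≡ b
fromℕ-injective refl = refl

∑-tabulate : {B : Set} (n : ℕ) (g : Fin n → B) (f : B → ℚ) → ∑ (List.tabulate g) f ≡ ∑ (List.allFin n) (λ i → f (g i))
∑-tabulate zero g f = refl
∑-tabulate (suc n) g f = cong (f (g Fin.zero) +_) (trans (∑-tabulate n (λ i → g (Fin.suc i)) f) (sym (∑-tabulate n Fin.suc (λ i → f (g i)))))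

∑-allFin-suc : (n : ℕ) (f : Fin (suc n) → ℚ) → ∑ (List.allFin (suc n)) f ≡ f Fin.zero + ∑ (List.allFin n) (λ i → f (Fin.suc i))
∑-allFin-suc n f = cong (f Fin.zero +_) (∑-tabulate n Fin.suc f)

∑-const-zero : {A : Set} (L : List A) → ∑ L (λ _ → 0ℚ) ≡ 0ℚ
∑-const-zero L = ∑-zero L _ (λ _ _ → refl)

suc-≟-suc : {n : ℕ} (a b : Fin n) → ⌊ Fin.suc a Fin.≟ Fin.suc b ⌋ ≡ ⌊ a Fin.≟ b ⌋
suc-≟-suc a b with a Fin.≟ b
... | yes _ = refl
... | no _ = refl

∑-allFin-point : (n : ℕ) (b : Fin n) (f : Fin n → ℚ) → ∑ (List.allFin n) (λ a → χ ⌊ a Fin.≟ b ⌋ * f a) ≡ f b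
∑-allFin-point (suc n) Fin.zero f rewrite ∑-allFin-suc n (λ a → χ ⌊ a Fin.≟ Fin.zero ⌋ * f a) =
  trans (cong₂ _+_ (QP.*-identityˡ (f Fin.zero)) (trans (∑-cong (List.allFin n) (λ i → QP.*-zeroˡ (f (Fin.suc i)))) (∑-const-zero
      (List.allFin n)))) (QP.+-identityʳ _)
∑-allFin-point (suc n) (Fin.suc b) f rewrite ∑-allFin-suc n (λ a → χ ⌊ a Fin.≟ Fin.suc b ⌋ * f a) =
  trans (cong₂ _+_ (QP.*-zeroˡ (f Fin.zero)) (trans (∑-cong (List.allFin n) (λ i → cong (λ z → χ z * f (Fin.suc i)) (suc-≟-suc i b)))
      (∑-allFin-point n b (λ i → f (Fin.suc i))))) (QP.+-identityˡ _)

Term : Set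
Term = ℕ × ℕ × ℚ

uDeg : Term → ℕ
uDeg t = proj₁ t
tDeg : Term → ℕ
tDeg t = proj₁ (proj₂ t)
coef : Term → ℚ
coef t = proj₂ (proj₂ t)

if-0≡χ* : (x : Bool) (c : ℚ) → (if x then c else 0ℚ) ≡ χ x * c
if-0≡χ* true c = sym (QP.*-identityˡ c)
if-0≡χ* false c = sym (QP.*-zeroˡ c)

coeff-as-∑ : (P : Poly) (i j : ℕ) → coeff P i j ≡ ∑ P (λ t → χ (⌊ uDeg t ℕ.≟ i ⌋ ∧ ⌊ tDeg t ℕ.≟ j ⌋) * coef t)
coeff-as-∑ [] i j = refl
coeff-as-∑ ((a , b , c) ∷ P) i j = cong₂ _+_ (if-0≡χ* (⌊ a ℕ.≟ i ⌋ ∧ ⌊ b ℕ.≟ j ⌋) c) (coeff-as-∑ P i j)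

coeff-++ : (P R : Poly) (i j : ℕ) → coeff (P ++ R) i j ≡ coeff P i j + coeff R i j
coeff-++ [] R i j = sym (QP.+-identityˡ _)
coeff-++ ((a , b , c) ∷ P) R i j = trans (cong ((if ⌊ a ℕ.≟ i ⌋ ∧ ⌊ b ℕ.≟ j ⌋ then c else 0ℚ) +_) (coeff-++ P R i j)) (sym (QP.+-assoc
    (if ⌊ a ℕ.≟ i ⌋ ∧ ⌊ b ℕ.≟ j ⌋ then c else 0ℚ) (coeff P i j) (coeff R i j)))

coeff-neg : (P : Poly) (i j : ℕ) → coeff (negP P) i j ≡ - coeff P i j
coeff-neg [] i j = refl
coeff-neg ((a , b , c) ∷ P) i j =
  trans (cong₂ _+_ (trans (if-0≡χ* x (- c)) (sym (QP.neg-distribʳ-* (χ x) c))) (coeff-neg P i j))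
    (trans (sym (QP.neg-distrib-+ (χ x * c) (coeff P i j))) (cong -_ (cong (_+ coeff P i j) (sym (if-0≡χ* x c)))))
  where x = ⌊ a ℕ.≟ i ⌋ ∧ ⌊ b ℕ.≟ j ⌋

coeff-sumP : {A : Set} (L : List A) (f : A → Poly) (i j : ℕ) → coeff (sumP L f) i j ≡ ∑ L (λ x → coeff (f x) i j)
coeff-sumP [] f i j = refl
coeff-sumP (x ∷ L) f i j = trans (coeff-++ (f x) _ i j) (cong (coeff (f x) i j +_) (coeff-sumP L f i j))

productCoeff : ℕ → ℕ → Term → Term → ℚ
productCoeff i j t t2 = χ (⌊ uDeg t ℕ.+ uDeg t2 ℕ.≟ i ⌋ ∧ ⌊ tDeg t ℕ.+ tDeg t2 ℕ.≟ j ⌋) * (coef t * coef t2)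

coeff-term-*-as-∑ : (a b : ℕ) (c : ℚ) (R : Poly) (i j : ℕ) → coeff (((a , b , c) ∷ []) *P R) i j ≡ ∑ R (λ t2 → productCoeff i j (a , b , c) t2)
coeff-term-*-as-∑ a b c [] i j = refl
coeff-term-*-as-∑ a b c ((a2 , b2 , c2) ∷ R) i j = cong₂ _+_ (if-0≡χ* (⌊ a ℕ.+ a2 ℕ.≟ i ⌋ ∧ ⌊ b ℕ.+ b2 ℕ.≟ j ⌋) (c * c2)) (coeff-term-*-as-∑ a b c R i j)

coeff-concatMap-as-∑ : (g : Term → Poly) (R : Poly) (i j : ℕ) → (∀ a b c → coeff (concatMap g ((a , b , c) ∷ [])) i j ≡ ∑ R
    (λ t2 → productCoeff i j (a , b , c) t2)) →
        ∀ P → coeff (concatMap g P) i j ≡ ∑ P (λ t → ∑ R (λ t2 → productCoeff i j t t2))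
coeff-concatMap-as-∑ g R i j H [] = refl
coeff-concatMap-as-∑ g R i j H ((a , b , c) ∷ P) =
  trans (coeff-++ (g (a , b , c)) (concatMap g P) i j)
    (cong₂ _+_ (trans (sym (trans (coeff-++ (g (a , b , c)) [] i j) (QP.+-identityʳ (coeff (g (a , b , c)) i j)))) (H a b c))
        (coeff-concatMap-as-∑ g R i j H P))

coeff-*-as-∑ : (P R : Poly) (i j : ℕ) → coeff (P *P R) i j ≡ ∑ P (λ t → ∑ R (λ t2 → productCoeff i j t t2))
coeff-*-as-∑ P R i j = coeff-concatMap-as-∑ _ R i j (λ a b c → coeff-term-*-as-∑ a b c R i j) P

shiftedCoeff : Poly → ℕ → ℕ → ℕ → ℕ → ℚ
shiftedCoeff R a b i j = ∑ R (λ t → χ (⌊ a ℕ.+ uDeg t ℕ.≟ i ⌋ ∧ ⌊ b ℕ.+ tDeg t ℕ.≟ j ⌋) * coef t)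

coeff-*-expandˡ : (P R : Poly) (i j : ℕ) → coeff (P *P R) i j ≡ ∑ P (λ t → coef t * shiftedCoeff R (uDeg t) (tDeg t) i j)
coeff-*-expandˡ P R i j = trans (coeff-*-as-∑ P R i j) (∑-cong P (λ t → trans (∑-cong R (λ t2 → productCoeff-factorˡ t t2)) (∑-*ˡ R (coef t) _)))
  where
  productCoeff-factorˡ : ∀ t t2 → productCoeff i j t t2 ≡ coef t * (χ (⌊ uDeg t ℕ.+ uDeg t2 ℕ.≟ i ⌋ ∧ ⌊ tDeg t ℕ.+ tDeg t2 ℕ.≟ j ⌋) * coef t2)
  productCoeff-factorˡ t t2 = solve 3 (λ x y z → x :* (y :* z) := y :* (x :* z)) refl (χ
      (⌊ uDeg t ℕ.+ uDeg t2 ℕ.≟ i ⌋ ∧ ⌊ tDeg t ℕ.+ tDeg t2 ℕ.≟ j ⌋)) (coef t) (coef t2)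

coeff-*-expandʳ : (P R : Poly) (i j : ℕ) → coeff (P *P R) i j ≡ ∑ R (λ t2 → coef t2 * shiftedCoeff P (uDeg t2) (tDeg t2) i j)
coeff-*-expandʳ P R i j = trans (coeff-*-as-∑ P R i j) (trans (∑-comm P R _) (∑-cong R (λ t2 → trans (∑-cong P
    (λ t → productCoeff-factorʳ t t2)) (∑-*ˡ P (coef t2) _))))
  where
  productCoeff-factorʳ : ∀ t t2 → productCoeff i j t t2 ≡ coef t2 * (χ (⌊ uDeg t2 ℕ.+ uDeg t ℕ.≟ i ⌋ ∧ ⌊ tDeg t2 ℕ.+ tDeg t ℕ.≟ j ⌋) * coef t)
  productCoeff-factorʳ t t2 rewrite NP.+-comm (uDeg t) (uDeg t2) | NP.+-comm (tDeg t) (tDeg t2) =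
    solve 3 (λ x y z → x :* (y :* z) := z :* (x :* y)) refl (χ (⌊ uDeg t2 ℕ.+ uDeg t ℕ.≟ i ⌋ ∧ ⌊ tDeg t2 ℕ.+ tDeg t ℕ.≟ j ⌋)) (coef t) (coef t2)

shiftedCoeff-0-0 : (R : Poly) (i j : ℕ) → shiftedCoeff R 0 0 i j ≡ coeff R i j
shiftedCoeff-0-0 R i j = sym (coeff-as-∑ R i j)

coeff-*-termʳ : (P : Poly) (a b : ℕ) (c : ℚ) (i j : ℕ) → coeff (P *P ((a , b , c) ∷ [])) i j ≡ c * shiftedCoeff P a b i j
coeff-*-termʳ P a b c i j = trans (coeff-*-expandʳ P _ i j) (QP.+-identityʳ _)

coeff-*-1P : (P : Poly) (i j : ℕ) → coeff (P *P 1P) i j ≡ coeff P i j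
coeff-*-1P P i j = trans (coeff-*-termʳ P 0 0 1ℚ i j) (trans (QP.*-identityˡ _) (shiftedCoeff-0-0 P i j))

coeff-*-0P : (P : Poly) (i j : ℕ) → coeff (P *P 0P) i j ≡ 0ℚ
coeff-*-0P P i j = coeff-*-expandʳ P [] i j

coeff-*-++ : (P R1 R2 : Poly) (i j : ℕ) → coeff (P *P (R1 ++ R2)) i j ≡ coeff (P *P R1) i j + coeff (P *P R2) i j
coeff-*-++ P R1 R2 i j = trans (coeff-*-expandʳ P _ i j) (trans (∑-++ R1 R2 _) (sym (cong₂ _+_ (coeff-*-expandʳ P R1 i j) (coeff-*-expandʳ P R2 i j))))

coeff-*-negP : (P R : Poly) (i j : ℕ) → coeff (P *P negP R) i j ≡ - coeff (P *P R) i j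
coeff-*-negP P [] i j = trans (coeff-*-0P P i j) (cong -_ (sym (coeff-*-0P P i j)))
coeff-*-negP P ((a , b , c) ∷ R) i j = begin
    coeff (P *P negP ((a , b , c) ∷ R)) i j
      ≡⟨ coeff-*-++ P ((a , b , - c) ∷ []) (negP R) i j ⟩
    coeff (P *P ((a , b , - c) ∷ [])) i j + coeff (P *P negP R) i j
      ≡⟨ cong₂ _+_ (coeff-*-termʳ P a b (- c) i j) (coeff-*-negP P R i j) ⟩
    - c * shiftedCoeff P a b i j + - coeff (P *P R) i j
      ≡⟨ cong (_+ - coeff (P *P R) i j) (sym (QP.neg-distribˡ-* c (shiftedCoeff P a b i j))) ⟩
    - (c * shiftedCoeff P a b i j) + - coeff (P *P R) i j
      ≡⟨ sym (QP.neg-distrib-+ (c * shiftedCoeff P a b i j) (coeff (P *P R) i j)) ⟩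
    - (c * shiftedCoeff P a b i j + coeff (P *P R) i j)
      ≡⟨ cong -_ (sym (trans (coeff-*-++ P ((a , b , c) ∷ []) R i j) (cong (_+ coeff (P *P R) i j) (coeff-*-termʳ P a b c i j)))) ⟩
    - coeff (P *P ((a , b , c) ∷ R)) i j ∎
  where open ≡-Reasoning

coeff-*-sumP : {A : Set} (P : Poly) (L : List A) (f : A → Poly) (i j : ℕ) → coeff (P *P sumP L f) i j ≡ ∑ L (λ x → coeff (P *P f x) i j)
coeff-*-sumP P [] f i j = coeff-*-0P P i j
coeff-*-sumP P (x ∷ L) f i j = trans (coeff-*-++ P (f x) _ i j) (cong (coeff (P *P f x) i j +_) (coeff-*-sumP P L f i j))

coeff-term-* : (a b : ℕ) (c : ℚ) (R : Poly) (i j : ℕ) → coeff (((a , b , c) ∷ []) *P R) i j ≡ c * shiftedCoeff R a b i j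
coeff-term-* a b c R i j = trans (coeff-*-expandˡ ((a , b , c) ∷ []) R i j) (QP.+-identityʳ _)

coeff-constℕ-*-monomial : (m e f : ℕ) (P : Poly) (i j : ℕ) →
  coeff (constℕ m *P (monomial e f *P P)) i j ≡ fromℕ m * shiftedCoeff P e f i j
coeff-constℕ-*-monomial m e f P i j = begin
    coeff (constℕ m *P (monomial e f *P P)) i j
      ≡⟨ coeff-term-* 0 0 ((ℤ.+ m) Q./ 1) (monomial e f *P P) i j ⟩
    (ℤ.+ m) Q./ 1 * shiftedCoeff (monomial e f *P P) 0 0 i j
      ≡⟨ cong₂ _*_ (/1≡fromℕ m) (shiftedCoeff-0-0 (monomial e f *P P) i j) ⟩
    fromℕ m * coeff (monomial e f *P P) i j
      ≡⟨ cong (fromℕ m *_) (trans (coeff-term-* e f 1ℚ P i j) (QP.*-identityˡ (shiftedCoeff P e f i j))) ⟩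
    fromℕ m * shiftedCoeff P e f i j ∎
  where open ≡-Reasoning

module _ {n p : ℕ} where
  =V⇒≡ : {μ ν : Tuple n p} → μ =V ν ≡ true → μ ≡ ν
  =V⇒≡ {μ} {ν} h with ≡-dec Fin._≟_ μ ν
  ... | yes e = e
  ... | no _ = case h of λ ()

  =V-refl : (μ : Tuple n p) → μ =V μ ≡ true
  =V-refl μ with ≡-dec Fin._≟_ μ μ
  ... | yes _ = refl
  ... | no ne = ⊥-elim (ne refl)

  ≡⇒=V : {μ ν : Tuple n p} → μ ≡ ν → μ =V ν ≡ true
  ≡⇒=V {μ} refl = =V-refl μ

  ≢⇒=V-false : {μ ν : Tuple n p} → ¬ (μ ≡ ν) → μ =V ν ≡ false
  ≢⇒=V-false {μ} {ν} ne with ≡-dec Fin._≟_ μ ν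
  ... | yes e = ⊥-elim (ne e)
  ... | no _ = refl

  χ=V-subst : (ν y : Tuple n p) (f : Tuple n p → ℚ) → χ (ν =V y) * f ν ≡ χ (ν =V y) * f y
  χ=V-subst ν y f with ≡-dec Fin._≟_ ν y
  ... | yes refl = refl
  ... | no _ = trans (QP.*-zeroˡ (f ν)) (sym (QP.*-zeroˡ (f y)))

=V-∷ : {n p : ℕ} (a b : Fin (suc p)) (μ ν : Tuple n p) → ((a ∷ μ) =V (b ∷ ν)) ≡ (⌊ a Fin.≟ b ⌋ ∧ (μ =V ν))
=V-∷ a b μ ν with a Fin.≟ b | ≡-dec Fin._≟_ μ ν
... | yes refl | yes refl = refl
... | yes refl | no ne = refl
... | no ne | _ = refl

∑-allTuples-point : (n p : ℕ) (y : Tuple n p) → ∑ (allTuples n p) (λ ν → χ (ν =V y)) ≡ 1ℚ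
∑-allTuples-point zero p [] = QP.+-identityʳ 1ℚ
∑-allTuples-point (suc n) p (y0 ∷ y) = begin
    ∑ (allTuples (suc n) p) (λ ν → χ (ν =V (y0 ∷ y)))
      ≡⟨ ∑-concatMap (λ a → map (a ∷_) (allTuples n p)) (List.allFin (suc p)) _ ⟩
    ∑ (List.allFin (suc p)) (λ a → ∑ (map (a ∷_) (allTuples n p)) (λ ν → χ (ν =V (y0 ∷ y))))
      ≡⟨ ∑-cong (List.allFin (suc p)) (λ a → trans (∑-map (a ∷_) (allTuples n p) _) (trans (∑-cong (allTuples n p) (λ ν → trans (cong χ
          (=V-∷ a y0 ν y)) (χ-∧ ⌊ a Fin.≟ y0 ⌋ (ν =V y)))) (∑-*ˡ (allTuples n p) (χ ⌊ a Fin.≟ y0 ⌋) _))) ⟩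
    ∑ (List.allFin (suc p)) (λ a → χ ⌊ a Fin.≟ y0 ⌋ * ∑ (allTuples n p) (λ ν → χ (ν =V y)))
      ≡⟨ ∑-allFin-point (suc p) y0 (λ _ → ∑ (allTuples n p) (λ ν → χ (ν =V y))) ⟩
    ∑ (allTuples n p) (λ ν → χ (ν =V y))
      ≡⟨ ∑-allTuples-point n p y ⟩
    1ℚ ∎
  where open ≡-Reasoning

module _ {n p q : ℕ} where
  ∑Γ-as-filter : (f : Tuple n p → ℚ) → ∑ (Γ n p q) f ≡ ∑ (allTuples n p) (λ ν → χ ⌊ nonzeroCount ν ℕ.≟ q ⌋ * f ν)
  ∑Γ-as-filter f = ∑-filter (allTuples n p) (λ v → nonzeroCount v ℕ.≟ q) f

  ∑Γ-cong : {f g : Tuple n p → ℚ} → (∀ x → InΓ q x → f x ≡ g x) → ∑ (Γ n p q) f ≡ ∑ (Γ n p q) g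
  ∑Γ-cong {f} {g} h = trans (∑Γ-as-filter f) (trans (∑-cong (allTuples n p) masked-cong) (sym (∑Γ-as-filter g)))
    where
    masked-cong : ∀ x → χ ⌊ nonzeroCount x ℕ.≟ q ⌋ * f x ≡ χ ⌊ nonzeroCount x ℕ.≟ q ⌋ * g x
    masked-cong x with nonzeroCount x ℕ.≟ q
    ... | yes e = cong (1ℚ *_) (h x e)
    ... | no _ = trans (QP.*-zeroˡ (f x)) (sym (QP.*-zeroˡ (g x)))

  ∑Γ-point : (y : Tuple n p) → InΓ q y → (f : Tuple n p → ℚ) → ∑ (Γ n p q) (λ ν → χ (ν =V y) * f ν) ≡ f y
  ∑Γ-point y yΓ f = begin
      ∑ (Γ n p q) (λ ν → χ (ν =V y) * f ν)
        ≡⟨ ∑-cong (Γ n p q) (λ ν → trans (χ=V-subst ν y f) (QP.*-comm _ (f y))) ⟩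
      ∑ (Γ n p q) (λ ν → f y * χ (ν =V y))
        ≡⟨ ∑-*ˡ (Γ n p q) (f y) _ ⟩
      f y * ∑ (Γ n p q) (λ ν → χ (ν =V y))
        ≡⟨ cong (f y *_) (trans (∑Γ-as-filter _) (trans (∑-cong (allTuples n p) mask-point) (∑-allTuples-point n p y))) ⟩
      f y * 1ℚ
        ≡⟨ QP.*-identityʳ (f y) ⟩
      f y ∎
    where
    open ≡-Reasoning
    mask-point : ∀ ν → χ ⌊ nonzeroCount ν ℕ.≟ q ⌋ * χ (ν =V y) ≡ χ (ν =V y)
    mask-point ν with ≡-dec Fin._≟_ ν y
    ... | no _ = QP.*-zeroʳ (χ ⌊ nonzeroCount ν ℕ.≟ q ⌋)
    ... | yes refl with nonzeroCount ν ℕ.≟ q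
    ...   | yes _ = QP.*-identityˡ 1ℚ
    ...   | no ne = ⊥-elim (ne yΓ)

  ∑Γ-zero : (f : Tuple n p → ℚ) → (∀ x → InΓ q x → f x ≡ 0ℚ) → ∑ (Γ n p q) f ≡ 0ℚ
  ∑Γ-zero f h = trans (∑Γ-cong {f} {λ _ → 0ℚ} h) (∑-const-zero (Γ n p q))

-- Content and level of a state

stat : {n p : ℕ} → (Fin (suc p) → ℕ) → Tuple n p → ℕ
stat w [] = 0
stat w (a ∷ μ) = w a ℕ.+ stat w μ

δ : {p : ℕ} → Fin (suc p) → Fin (suc p) → ℕ
δ v a = if ⌊ v Fin.≟ a ⌋ then 1 else 0

multiplicity : {n p : ℕ} → Fin (suc p) → Tuple n p → ℕ
multiplicity v = stat (δ v)

content : {n p : ℕ} → Tuple n p → Vec ℕ (suc p)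
content μ = tabulate (λ v → multiplicity v μ)

content⇒multiplicity : {n p : ℕ} (μ ν : Tuple n p) → content μ ≡ content ν → ∀ v → multiplicity v μ ≡ multiplicity v ν
content⇒multiplicity μ ν e v = trans (sym (VP.lookup∘tabulate (λ v → multiplicity v μ) v)) (trans (cong (λ c → lookup c v) e)
    (VP.lookup∘tabulate (λ v → multiplicity v ν) v))

multiplicity⇒content : {n p : ℕ} (μ ν : Tuple n p) → (∀ v → multiplicity v μ ≡ multiplicity v ν) → content μ ≡ content ν
multiplicity⇒content μ ν h = VP.tabulate-cong h

stat-update : {n p : ℕ} (w : Fin (suc p) → ℕ) (μ : Tuple n p) (i : Fin n) (b : Fin (suc p)) →
           stat w (μ [ i ]≔ b) ℕ.+ w (lookup μ i) ≡ stat w μ ℕ.+ w b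
stat-update w (a ∷ μ) Fin.zero b = NS.solve 3 (λ x y z → (x NS.:+ y) NS.:+ z NS.:= (z NS.:+ y) NS.:+ x) refl (w b) (stat w μ) (w a)
stat-update w (a ∷ μ) (Fin.suc i) b = trans (NP.+-assoc (w a) _ (w (lookup μ i))) (trans (cong (w a ℕ.+_) (stat-update w μ i b)) (sym
    (NP.+-assoc (w a) (stat w μ) (w b))))

fromℕ-δ : {p : ℕ} (v a : Fin (suc p)) → fromℕ (δ v a) ≡ χ ⌊ v Fin.≟ a ⌋
fromℕ-δ v a with v Fin.≟ a
... | yes _ = refl
... | no _ = refl

fromℕ-stat : {n p : ℕ} (w : Fin (suc p) → ℕ) (μ : Tuple n p) → fromℕ (stat w μ) ≡ ∑ (List.allFin n) (λ i → fromℕ (w (lookup μ i)))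
fromℕ-stat w [] = refl
fromℕ-stat {suc n} w (a ∷ μ) = trans (fromℕ-+ (w a) (stat w μ)) (trans (cong (fromℕ (w a) +_) (fromℕ-stat w μ)) (sym (∑-allFin-suc n
    (λ i → fromℕ (w (lookup (a ∷ μ) i))))))

∑-by-multiplicity : {n p : ℕ} (μ : Tuple n p) (H : Fin (suc p) → ℚ) →
           ∑ (List.allFin n) (λ i → H (lookup μ i)) ≡ ∑ (List.allFin (suc p)) (λ v → fromℕ (multiplicity v μ) * H v)
∑-by-multiplicity {p = p} [] H = sym (trans (∑-cong (List.allFin (suc p)) (λ v → QP.*-zeroˡ (H v))) (∑-const-zero (List.allFin (suc p))))
∑-by-multiplicity {suc n} {p} (a ∷ μ) H = begin
    ∑ (List.allFin (suc n)) (λ i → H (lookup (a ∷ μ) i))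
      ≡⟨ ∑-allFin-suc n (λ i → H (lookup (a ∷ μ) i)) ⟩
    H a + ∑ (List.allFin n) (λ i → H (lookup μ i))
      ≡⟨ cong₂ _+_ (sym (∑-allFin-point (suc p) a H)) (∑-by-multiplicity μ H) ⟩
    ∑ (List.allFin (suc p)) (λ v → χ ⌊ v Fin.≟ a ⌋ * H v) + ∑ (List.allFin (suc p)) (λ v → fromℕ (multiplicity v μ) * H v)
      ≡⟨ sym (∑-+ (List.allFin (suc p)) (λ v → χ ⌊ v Fin.≟ a ⌋ * H v) (λ v → fromℕ (multiplicity v μ) * H v)) ⟩
    ∑ (List.allFin (suc p)) (λ v → χ ⌊ v Fin.≟ a ⌋ * H v + fromℕ (multiplicity v μ) * H v)
      ≡⟨ ∑-cong (List.allFin (suc p)) (λ v → trans (sym (QP.*-distribʳ-+ (H v) (χ ⌊ v Fin.≟ a ⌋) (fromℕ (multiplicity v μ))))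
            (cong (_* H v) (sym (trans (fromℕ-+ (δ v a) (multiplicity v μ)) (cong (_+ fromℕ (multiplicity v μ)) (fromℕ-δ v a)))))) ⟩
    ∑ (List.allFin (suc p)) (λ v → fromℕ (multiplicity v (a ∷ μ)) * H v) ∎
  where open ≡-Reasoning

∑-content-invariant : {n p : ℕ} (μ ν : Tuple n p) → content μ ≡ content ν → (H : Fin (suc p) → ℚ) →
         ∑ (List.allFin n) (λ i → H (lookup μ i)) ≡ ∑ (List.allFin n) (λ i → H (lookup ν i))
∑-content-invariant {p = p} μ ν e H = trans (∑-by-multiplicity μ H) (trans (∑-cong (List.allFin (suc p)) (λ v → cong (λ k → fromℕ k * H v)
    (content⇒multiplicity μ ν e v))) (sym (∑-by-multiplicity ν H)))

stat-content-invariant : {n p : ℕ} (μ ν : Tuple n p) → content μ ≡ content ν → (w : Fin (suc p) → ℕ) → stat w μ ≡ stat w ν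
stat-content-invariant μ ν e w = fromℕ-injective (trans (fromℕ-stat w μ) (trans (∑-content-invariant μ ν e (λ a → fromℕ (w a))) (sym (fromℕ-stat w ν))))

isNonzero : {p : ℕ} → Fin (suc p) → ℕ
isNonzero Fin.zero = 0
isNonzero (Fin.suc _) = 1

nonzeroCount-stat : {n p : ℕ} (μ : Tuple n p) → nonzeroCount μ ≡ stat isNonzero μ
nonzeroCount-stat [] = refl
nonzeroCount-stat (Fin.zero ∷ μ) = nonzeroCount-stat μ
nonzeroCount-stat (Fin.suc _ ∷ μ) = cong suc (nonzeroCount-stat μ)

excess : {p : ℕ} → Fin (suc p) → ℕ
excess a = ℕ.pred (toℕ a)

level : {n p : ℕ} → Tuple n p → ℕ
level = stat excess

moveContent : {p : ℕ} → Vec ℕ (suc p) → Fin (suc p) → Fin (suc p) → Vec ℕ (suc p)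
moveContent c a b = tabulate (λ v → (lookup c v ℕ.+ δ v b) ℕ.∸ δ v a)

content-update : {n p : ℕ} (μ : Tuple n p) (i : Fin n) (b : Fin (suc p)) → content (μ [ i ]≔ b) ≡ moveContent (content μ) (lookup μ i) b
content-update μ i b = VP.tabulate-cong (λ v → trans (sym (NP.m+n∸n≡m (multiplicity v (μ [ i ]≔ b)) (δ v (lookup μ i))))
   (cong (ℕ._∸ δ v (lookup μ i)) (trans (stat-update (δ v) μ i b) (cong (ℕ._+ δ v b) (sym (VP.lookup∘tabulate (λ v → multiplicity v μ) v))))))

level0Multiplicity : {p : ℕ} → Fin (suc p) → ℕ → ℕ → ℕ
level0Multiplicity Fin.zero n z = n ℕ.∸ z
level0Multiplicity (Fin.suc Fin.zero) n z = z
level0Multiplicity (Fin.suc (Fin.suc _)) n z = 0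

nonzeroCount≤n : {n p : ℕ} (μ : Tuple n p) → nonzeroCount μ ℕ.≤ n
nonzeroCount≤n [] = ℕ.z≤n
nonzeroCount≤n (Fin.zero ∷ μ) = NP.m≤n⇒m≤1+n (nonzeroCount≤n μ)
nonzeroCount≤n (Fin.suc _ ∷ μ) = ℕ.s≤s (nonzeroCount≤n μ)

level0-multiplicity : {n p : ℕ} (μ : Tuple n p) → level μ ≡ 0 → ∀ v → multiplicity v μ ≡ level0Multiplicity v n (nonzeroCount μ)
level0-multiplicity [] e Fin.zero = refl
level0-multiplicity [] e (Fin.suc Fin.zero) = refl
level0-multiplicity [] e (Fin.suc (Fin.suc _)) = refl
level0-multiplicity (Fin.zero ∷ μ) e Fin.zero = trans (cong suc (level0-multiplicity μ e Fin.zero)) (sym (NP.+-∸-assoc 1 (nonzeroCount≤n μ)))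
level0-multiplicity (Fin.zero ∷ μ) e (Fin.suc Fin.zero) = level0-multiplicity μ e (Fin.suc Fin.zero)
level0-multiplicity (Fin.zero ∷ μ) e (Fin.suc (Fin.suc v)) = level0-multiplicity μ e (Fin.suc (Fin.suc v))
level0-multiplicity (Fin.suc Fin.zero ∷ μ) e Fin.zero = level0-multiplicity μ e Fin.zero
level0-multiplicity (Fin.suc Fin.zero ∷ μ) e (Fin.suc Fin.zero) = cong suc (trans (level0-multiplicity μ e (Fin.suc Fin.zero)) refl)
level0-multiplicity (Fin.suc Fin.zero ∷ μ) e (Fin.suc (Fin.suc v)) = level0-multiplicity μ e (Fin.suc (Fin.suc v))
level0-multiplicity (Fin.suc (Fin.suc a) ∷ μ) () v

level0-content-unique : {n p q : ℕ} (μ ν : Tuple n p) → InΓ q μ → InΓ q ν → level μ ≡ 0 → level ν ≡ 0 → content μ ≡ content ν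
level0-content-unique {n} μ ν eμ eν lμ lν = multiplicity⇒content μ ν (λ v → trans (level0-multiplicity μ lμ v) (trans (cong
    (level0Multiplicity v n) (trans eμ (sym eν))) (sym (level0-multiplicity ν lν v))))

-- Orbits are content classes

≟-permute : {n : ℕ} (σ : Permutation′ n) (i j : Fin n) → ⌊ j Fin.≟ (σ ⟨$⟩ʳ i) ⌋ ≡ ⌊ i Fin.≟ (σ ⟨$⟩ˡ j) ⌋
≟-permute σ i j with j Fin.≟ (σ ⟨$⟩ʳ i) | i Fin.≟ (σ ⟨$⟩ˡ j)
... | yes _ | yes _ = refl
... | no _ | no _ = refl
... | yes e | no ne = ⊥-elim (ne (trans (sym (Perm.inverseˡ σ)) (cong (σ ⟨$⟩ˡ_) (sym e))))
... | no ne | yes e = ⊥-elim (ne (trans (sym (Perm.inverseʳ σ)) (cong (σ ⟨$⟩ʳ_) (sym e))))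

∑-permute : {n : ℕ} (σ : Permutation′ n) (g : Fin n → ℚ) → ∑ (List.allFin n) (λ i → g (σ ⟨$⟩ʳ i)) ≡ ∑ (List.allFin n) g
∑-permute {n} σ g = begin
    ∑ (List.allFin n) (λ i → g (σ ⟨$⟩ʳ i))
      ≡⟨ ∑-cong (List.allFin n) (λ i → sym (∑-allFin-point n (σ ⟨$⟩ʳ i) g)) ⟩
    ∑ (List.allFin n) (λ i → ∑ (List.allFin n) (λ j → χ ⌊ j Fin.≟ (σ ⟨$⟩ʳ i) ⌋ * g j))
      ≡⟨ ∑-comm (List.allFin n) (List.allFin n) (λ i j → χ ⌊ j Fin.≟ (σ ⟨$⟩ʳ i) ⌋ * g j) ⟩
    ∑ (List.allFin n) (λ j → ∑ (List.allFin n) (λ i → χ ⌊ j Fin.≟ (σ ⟨$⟩ʳ i) ⌋ * g j))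
      ≡⟨ ∑-cong (List.allFin n) (λ j → trans (∑-*ʳ (List.allFin n) (g j) (λ i → χ ⌊ j Fin.≟ (σ ⟨$⟩ʳ i) ⌋))
           (trans (cong (_* g j) (trans (∑-cong (List.allFin n) (λ i → trans (cong χ (≟-permute σ i j)) (sym (QP.*-identityʳ _))))
              (∑-allFin-point n (σ ⟨$⟩ˡ j) (λ _ → 1ℚ)))) (QP.*-identityˡ (g j)))) ⟩
    ∑ (List.allFin n) g ∎
  where open ≡-Reasoning

content-act : {n p : ℕ} (σ : Permutation′ n) (x : Tuple n p) → content (act σ x) ≡ content x
content-act {n} σ x = multiplicity⇒content (act σ x) x (λ v → fromℕ-injective (trans (fromℕ-stat (δ v) (act σ x))
   (trans (∑-cong (List.allFin n) (λ i → cong (λ a → fromℕ (δ v a)) (VP.lookup∘tabulate (λ i → lookup x (σ ⟨$⟩ʳ i)) i)))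
    (trans (∑-permute σ (λ i → fromℕ (δ v (lookup x i)))) (sym (fromℕ-stat (δ v) x))))))

orbit⇒content : {n p : ℕ} (x y : Tuple n p) → InOrbit x y → content y ≡ content x
orbit⇒content x y (σ , refl) = content-act σ x

multiplicity-insertAt : {n p : ℕ} (xs : Tuple n p) (j : Fin (suc n)) (a v : Fin (suc p)) → multiplicity v (insertAt xs j a) ≡ δ v a ℕ.+ multiplicity v xs
multiplicity-insertAt xs Fin.zero a v = refl
multiplicity-insertAt (b ∷ xs) (Fin.suc j) a v = trans (cong (δ v b ℕ.+_) (multiplicity-insertAt xs j a v))
  (trans (sym (NP.+-assoc (δ v b) (δ v a) (multiplicity v xs))) (trans (cong (ℕ._+ multiplicity v xs) (NP.+-comm (δ v b) (δ v a)))
      (NP.+-assoc (δ v a) (δ v b) (multiplicity v xs))))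

position : {n p : ℕ} (x : Tuple n p) (v : Fin (suc p)) → ¬ (multiplicity v x ≡ 0) → Σ[ j ∈ Fin n ] lookup x j ≡ v
position [] v h = ⊥-elim (h refl)
position (a ∷ x) v h with v Fin.≟ a
... | yes e = Fin.zero , sym e
... | no _ with position x v h
...   | j , e = Fin.suc j , e

δ-refl : {p : ℕ} (v : Fin (suc p)) → δ v v ≡ 1
δ-refl v with v Fin.≟ v
... | yes _ = refl
... | no ne = ⊥-elim (ne refl)

content⇒orbit : {n p : ℕ} (x y : Tuple n p) → content y ≡ content x → InOrbit x y
content⇒orbit [] [] e = Perm.id , refl
content⇒orbit {suc m} {p} x (y0 ∷ y) e = σ , eq
  where
  fj : Σ[ j ∈ Fin (suc m) ] lookup x j ≡ y0
  fj = position x y0 (λ h → NP.1+n≢0 (trans (cong (ℕ._+ multiplicity y0 y) (sym (δ-refl y0))) (trans (content⇒multiplicity (y0 ∷ y) x e y0) h)))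
  j : Fin (suc m)
  j = proj₁ fj
  x1 : Tuple m p
  x1 = removeAt x j
  xe : insertAt x1 j y0 ≡ x
  xe = trans (cong (insertAt x1 j) (sym (proj₂ fj))) (VP.insertAt-removeAt x j)
  eY : content y ≡ content x1
  eY = multiplicity⇒content y x1 (λ v → NP.+-cancelˡ-≡ (δ v y0) _ _ (trans (content⇒multiplicity (y0 ∷ y) x e v) (trans (cong
      (multiplicity v) (sym xe)) (multiplicity-insertAt x1 j y0 v))))
  ih : InOrbit x1 y
  ih = content⇒orbit x1 y eY
  σ1 : Permutation′ m
  σ1 = proj₁ ih
  σ : Permutation′ (suc m)
  σ = Perm.insert Fin.zero j σ1
  eq : y0 ∷ y ≡ act σ x
  eq = cong₂ _∷_ (sym (proj₂ fj)) (trans (proj₂ ih) (VP.tabulate-cong (λ i → sym (trans (cong (lookup x) (Perm.insert-punchIn Fin.zero j σ1 i))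
          (trans (cong (λ z → lookup z (Fin.punchIn j (σ1 ⟨$⟩ʳ i))) (sym xe)) (VP.insertAt-punchIn x1 j y0 (σ1 ⟨$⟩ʳ i)))))))

incr : {p : ℕ} → Fin (suc p) → Fin (suc p)
incr {p} v with toℕ v ℕ.<? p
... | yes h = Fin.fromℕ< (ℕ.s≤s h)
... | no _ = v

toℕ-incr : {p : ℕ} (v : Fin (suc p)) → toℕ v ℕ.< p → toℕ (incr v) ≡ suc (toℕ v)
toℕ-incr {p} v h with toℕ v ℕ.<? p
... | yes h2 = FP.toℕ-fromℕ< (ℕ.s≤s h2)
... | no nh = ⊥-elim (nh h)

decr : {p : ℕ} → Fin (suc p) → Fin (suc p)
decr Fin.zero = Fin.zero
decr (Fin.suc v) = Fin.inject₁ v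

toℕ-decr : {p : ℕ} (v : Fin (suc p)) → toℕ (decr v) ≡ ℕ.pred (toℕ v)
toℕ-decr Fin.zero = refl
toℕ-decr (Fin.suc v) = FP.toℕ-inject₁ v

raisable : {p : ℕ} → Fin (suc p) → Bool
raisable {p} v = ⌊ 1 ℕ.≤? toℕ v ⌋ ∧ ⌊ toℕ v ℕ.<? p ⌋

lowerable : {p : ℕ} → Fin (suc p) → Bool
lowerable v = ⌊ 2 ℕ.≤? toℕ v ⌋

raisable-bounds : {p : ℕ} (v : Fin (suc p)) → raisable v ≡ true → (1 ℕ.≤ toℕ v) × (toℕ v ℕ.< p)
raisable-bounds {p} v h = ⌊⌋-true⇒ (1 ℕ.≤? toℕ v) (∧-l ⌊ 1 ℕ.≤? toℕ v ⌋ h) , ⌊⌋-true⇒ (toℕ v ℕ.<? p) (∧-r ⌊ 1 ℕ.≤? toℕ v ⌋ h)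

lowerable-bound : {p : ℕ} (v : Fin (suc p)) → lowerable v ≡ true → 2 ℕ.≤ toℕ v
lowerable-bound v h = ⌊⌋-true⇒ (2 ℕ.≤? toℕ v) h

module _ {n p : ℕ} where
  raises : Fin n → Tuple n p → Tuple n p → Bool
  raises i μ ν = (ν =V (μ [ i ]≔ lookup ν i)) ∧ ⌊ toℕ (lookup ν i) ℕ.≟ suc (toℕ (lookup μ i)) ⌋ ∧ ⌊ 1 ℕ.≤? toℕ (lookup μ i) ⌋

  raiseAt : Fin n → Tuple n p → Tuple n p
  raiseAt i μ = μ [ i ]≔ incr (lookup μ i)

  lowerAt : Fin n → Tuple n p → Tuple n p
  lowerAt i ν = ν [ i ]≔ decr (lookup ν i)

  update-flip : (i : Fin n) (μ ν : Tuple n p) → ν ≡ μ [ i ]≔ lookup ν i → μ ≡ ν [ i ]≔ lookup μ i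
  update-flip i μ ν e = sym (trans (cong (λ z → z [ i ]≔ lookup μ i) e) (trans (VP.[]≔-idempotent μ i) (VP.[]≔-lookup μ i)))

  onlyAt-sym : (i : Fin n) (μ ν : Tuple n p) → (ν =V (μ [ i ]≔ lookup ν i)) ≡ (μ =V (ν [ i ]≔ lookup μ i))
  onlyAt-sym i μ ν = Bool-ext (λ h → ≡⇒=V (update-flip i μ ν (=V⇒≡ h))) (λ h → ≡⇒=V (update-flip i ν μ (=V⇒≡ h)))

  raises-only : (i : Fin n) (μ ν : Tuple n p) → raises i μ ν ≡ true → ν ≡ μ [ i ]≔ lookup ν i
  raises-only i μ ν h = =V⇒≡ (∧-l (ν =V (μ [ i ]≔ lookup ν i)) h)

  raises-suc : (i : Fin n) (μ ν : Tuple n p) → raises i μ ν ≡ true → toℕ (lookup ν i) ≡ suc (toℕ (lookup μ i))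
  raises-suc i μ ν h = ⌊⌋-true⇒ (toℕ (lookup ν i) ℕ.≟ suc (toℕ (lookup μ i)))
    (∧-l ⌊ toℕ (lookup ν i) ℕ.≟ suc (toℕ (lookup μ i)) ⌋ (∧-r (ν =V (μ [ i ]≔ lookup ν i)) h))

  raises-nonzero : (i : Fin n) (μ ν : Tuple n p) → raises i μ ν ≡ true → 1 ℕ.≤ toℕ (lookup μ i)
  raises-nonzero i μ ν h = ⌊⌋-true⇒ (1 ℕ.≤? toℕ (lookup μ i))
    (∧-r ⌊ toℕ (lookup ν i) ℕ.≟ suc (toℕ (lookup μ i)) ⌋ (∧-r (ν =V (μ [ i ]≔ lookup ν i)) h))

  raises-intro : (i : Fin n) (μ ν : Tuple n p) → ν ≡ μ [ i ]≔ lookup ν i →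
    toℕ (lookup ν i) ≡ suc (toℕ (lookup μ i)) → 1 ℕ.≤ toℕ (lookup μ i) → raises i μ ν ≡ true
  raises-intro i μ ν only step nonzero =
    ∧-i (≡⇒=V only) (∧-i (⌊⌋-true⇐ (_ ℕ.≟ _) step) (⌊⌋-true⇐ (1 ℕ.≤? _) nonzero))

  raises⇔raiseAt : (i : Fin n) (μ ν : Tuple n p) → raises i μ ν ≡ raisable (lookup μ i) ∧ (ν =V raiseAt i μ)
  raises⇔raiseAt i μ ν = Bool-ext fwd bwd
    where
    fwd : raises i μ ν ≡ true → raisable (lookup μ i) ∧ (ν =V raiseAt i μ) ≡ true
    fwd h = ∧-i (∧-i (⌊⌋-true⇐ (1 ℕ.≤? _) (raises-nonzero i μ ν h)) (⌊⌋-true⇐ (_ ℕ.<? p) below-p))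
                (≡⇒=V (trans (raises-only i μ ν h) (cong (μ [ i ]≔_) is-incr)))
      where
      below-p : toℕ (lookup μ i) ℕ.< p
      below-p = ℕ.s≤s⁻¹ (subst (ℕ._< suc p) (raises-suc i μ ν h) (FP.toℕ<n (lookup ν i)))
      is-incr : lookup ν i ≡ incr (lookup μ i)
      is-incr = FP.toℕ-injective (trans (raises-suc i μ ν h) (sym (toℕ-incr (lookup μ i) below-p)))
    bwd : raisable (lookup μ i) ∧ (ν =V raiseAt i μ) ≡ true → raises i μ ν ≡ true
    bwd h = raises-intro i μ ν (trans ν≡ (cong (μ [ i ]≔_) (sym is-incr)))
              (trans (cong toℕ is-incr) (toℕ-incr (lookup μ i) (proj₂ bounds))) (proj₁ bounds)
      where
      bounds : (1 ℕ.≤ toℕ (lookup μ i)) × (toℕ (lookup μ i) ℕ.< p)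
      bounds = raisable-bounds (lookup μ i) (∧-l (raisable (lookup μ i)) h)
      ν≡ : ν ≡ raiseAt i μ
      ν≡ = =V⇒≡ (∧-r (raisable (lookup μ i)) h)
      is-incr : lookup ν i ≡ incr (lookup μ i)
      is-incr = trans (cong (λ z → lookup z i) ν≡) (VP.lookup∘update i μ _)

  raises⇔lowerAt : (i : Fin n) (μ ν : Tuple n p) → raises i μ ν ≡ lowerable (lookup ν i) ∧ (μ =V lowerAt i ν)
  raises⇔lowerAt i μ ν = Bool-ext fwd bwd
    where
    fwd : raises i μ ν ≡ true → lowerable (lookup ν i) ∧ (μ =V lowerAt i ν) ≡ true
    fwd h = ∧-i (⌊⌋-true⇐ (2 ℕ.≤? _) (subst (2 ℕ.≤_) (sym (raises-suc i μ ν h)) (ℕ.s≤s (raises-nonzero i μ ν h))))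
                (≡⇒=V (trans (update-flip i μ ν (raises-only i μ ν h)) (cong (ν [ i ]≔_) is-decr)))
      where
      is-decr : lookup μ i ≡ decr (lookup ν i)
      is-decr = FP.toℕ-injective (sym (trans (toℕ-decr (lookup ν i)) (cong ℕ.pred (raises-suc i μ ν h))))
    bwd : lowerable (lookup ν i) ∧ (μ =V lowerAt i ν) ≡ true → raises i μ ν ≡ true
    bwd h = raises-intro i μ ν (update-flip i ν μ (trans μ≡ (cong (ν [ i ]≔_) (sym is-decr)))) (sym step)
              (ℕ.s≤s⁻¹ (subst (2 ℕ.≤_) (sym step) two≤))
      where
      two≤ : 2 ℕ.≤ toℕ (lookup ν i)
      two≤ = lowerable-bound (lookup ν i) (∧-l (lowerable (lookup ν i)) h)
      μ≡ : μ ≡ lowerAt i ν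
      μ≡ = =V⇒≡ (∧-r (lowerable (lookup ν i)) h)
      is-decr : lookup μ i ≡ decr (lookup ν i)
      is-decr = trans (cong (λ z → lookup z i) μ≡) (VP.lookup∘update i ν _)
      step : suc (toℕ (lookup μ i)) ≡ toℕ (lookup ν i)
      step = trans (cong (suc ∘ toℕ) is-decr) (trans (cong suc (toℕ-decr (lookup ν i))) (NP.suc-pred (toℕ (lookup ν i)) {{ℕ.>-nonZero
          (NP.≤-trans (ℕ.s≤s ℕ.z≤n) two≤)}}))

  raises-asym : (i : Fin n) (μ ν : Tuple n p) → raises i μ ν ≡ true → raises i ν μ ≡ false
  raises-asym i μ ν h with raises i ν μ in h′
  ... | false = refl
  ... | true = ⊥-elim (NP.m+1+n≢n 1 (sym (trans (raises-suc i μ ν h) (cong suc (raises-suc i ν μ h′)))))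

coeff-*-upDown : (P : Poly) (a b : ℕ) (k1 k2 : Bool) → (k1 ≡ true → k2 ≡ false) →
         coeff (P *P (if k1 then varU else if k2 then 1P else 0P)) a b ≡ χ k1 * shiftedCoeff P 1 0 a b + χ k2 * coeff P a b
coeff-*-upDown P a b true false h = trans (coeff-*-termʳ P 1 0 1ℚ a b) (sym (trans (cong (1ℚ * shiftedCoeff P 1 0 a b +_) (QP.*-zeroˡ
    (coeff P a b))) (QP.+-identityʳ _)))
coeff-*-upDown P a b true true h = case h refl of λ ()
coeff-*-upDown P a b false true h = trans (coeff-*-1P P a b) (sym (trans (cong (_+ 1ℚ * coeff P a b) (QP.*-zeroˡ (shiftedCoeff P 1 0 a b)))
    (trans (QP.+-identityˡ _) (QP.*-identityˡ _))))
coeff-*-upDown P a b false false h = trans (coeff-*-0P P a b) (sym (trans (cong₂ _+_ (QP.*-zeroˡ (shiftedCoeff P 1 0 a b)) (QP.*-zeroˡ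
    (coeff P a b))) (QP.+-identityʳ 0ℚ)))

module _ {n p : ℕ} where
  coeff-*-changeRate : (P : Poly) (i : Fin n) (μ ν : Tuple n p) (a b : ℕ) →
    coeff (P *P changeRate i μ ν) a b ≡ χ (raises i μ ν) * shiftedCoeff P 1 0 a b + χ (raises i ν μ) * coeff P a b
  coeff-*-changeRate P i μ ν a b =
    trans (cong (λ k2 → coeff (P *P (if raises i μ ν then varU else if k2 then 1P else 0P)) a b) e)
      (coeff-*-upDown P a b (raises i μ ν) (raises i ν μ) (raises-asym i μ ν))
    where
    e : ((ν =V (μ [ i ]≔ lookup ν i)) ∧ ⌊ toℕ (lookup μ i) ℕ.≟ suc (toℕ (lookup ν i)) ⌋ ∧ ⌊ 1 ℕ.≤? toℕ (lookup ν i) ⌋) ≡ raises i ν μ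
    e = cong (_∧ (⌊ toℕ (lookup μ i) ℕ.≟ suc (toℕ (lookup ν i)) ⌋ ∧ ⌊ 1 ℕ.≤? toℕ (lookup ν i) ⌋)) (onlyAt-sym i μ ν)

  coeff-*-if-false : (P : Poly) (a b : ℕ) (c : Bool) (X : Poly) → (c ≡ true → ⊥) → coeff (P *P (if c then X else 0P)) a b ≡ 0ℚ
  coeff-*-if-false P a b true X h = ⊥-elim (h refl)
  coeff-*-if-false P a b false X h = coeff-*-0P P a b

  lookup-update-copy : (μ : Tuple n p) (k k2 : Fin n) → lookup (μ [ k ]≔ lookup μ k2) k2 ≡ lookup μ k2
  lookup-update-copy μ k k2 with k Fin.≟ k2
  ... | yes refl = VP.lookup∘update k μ _
  ... | no ne = VP.lookup∘update′ (λ e → ne (sym e)) μ _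

  content-swapAt : (k : Fin n) (μ : Tuple n p) → content (swapAt k μ) ≡ content μ
  content-swapAt k μ = multiplicity⇒content (swapAt k μ) μ (λ v → NP.+-cancelʳ-≡ (δ v b0) _ _
     (trans (cong (λ z → multiplicity v (swapAt k μ) ℕ.+ δ v z) (sym (lookup-update-copy μ k (next k))))
       (trans (stat-update (δ v) μ1 (next k) a0) (stat-update (δ v) μ k b0))))
    where
    a0 b0 : Fin (suc p)
    a0 = lookup μ k
    b0 = lookup μ (next k)
    μ1 : Tuple n p
    μ1 = μ [ k ]≔ b0

  coeff-*-swapRate-across : (P : Poly) (a b : ℕ) (k : Fin n) (μ ν : Tuple n p) → ¬ (content ν ≡ content μ) → coeff (P *P swapRate k μ ν) a b ≡ 0ℚ
  coeff-*-swapRate-across P a b k μ ν ne = coeff-*-if-false P a b (not ⌊ lookup μ k Fin.≟ lookup μ (next k) ⌋ ∧ (ν =V swapAt k μ)) _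
    (λ h → ne (trans (cong content (=V⇒≡ (∧-r (not ⌊ lookup μ k Fin.≟ lookup μ (next k) ⌋) h))) (content-swapAt k μ)))

  coeff-*-swapRate-diag : (P : Poly) (a b : ℕ) (k : Fin n) (ν : Tuple n p) → coeff (P *P swapRate k ν ν) a b ≡ 0ℚ
  coeff-*-swapRate-diag P a b k ν = coeff-*-if-false P a b (not ⌊ lookup ν k Fin.≟ lookup ν (next k) ⌋ ∧ (ν =V swapAt k ν)) _ differs
    where
    differs : (not ⌊ lookup ν k Fin.≟ lookup ν (next k) ⌋ ∧ (ν =V swapAt k ν)) ≡ true → ⊥
    differs h with lookup ν k Fin.≟ lookup ν (next k)
    ... | yes _ = case h of λ ()
    ... | no ne with k Fin.≟ next k
    ...   | yes e = ne (cong (lookup ν) e)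
    ...   | no nk = ne (trans (cong (λ z → lookup z k) (=V⇒≡ h)) (trans (VP.lookup∘update′ nk (ν [ k ]≔ lookup ν (next k)) _) (VP.lookup∘update k ν _)))

  raises-irrefl : (i : Fin n) (ν : Tuple n p) → raises i ν ν ≡ false
  raises-irrefl i ν with raises i ν ν in e
  ... | false = refl
  ... | true = ⊥-elim (NP.1+n≢n (sym (raises-suc i ν ν e)))

isNonzero-pos : {p : ℕ} (v : Fin (suc p)) → 1 ℕ.≤ toℕ v → isNonzero v ≡ 1
isNonzero-pos (Fin.suc v) _ = refl

module _ {n p q : ℕ} where
  update-Γ : (μ : Tuple n p) (i : Fin n) (w : Fin (suc p)) → 1 ℕ.≤ toℕ (lookup μ i) → 1 ℕ.≤ toℕ w → InΓ q μ → InΓ q (μ [ i ]≔ w)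
  update-Γ μ i w h1 h2 e = trans (nonzeroCount-stat (μ [ i ]≔ w)) (NP.+-cancelʳ-≡ 1 _ _
     (trans (cong (stat isNonzero (μ [ i ]≔ w) ℕ.+_) (sym (isNonzero-pos _ h1))) (trans (stat-update isNonzero μ i w)
       (trans (cong₂ ℕ._+_ (trans (sym (nonzeroCount-stat μ)) e) (isNonzero-pos w h2)) refl))))

  raiseAt-Γ : (i : Fin n) (μ : Tuple n p) → raisable (lookup μ i) ≡ true → InΓ q μ → InΓ q (raiseAt i μ)
  raiseAt-Γ i μ h e = update-Γ μ i _ (proj₁ rp) (subst (1 ℕ.≤_) (sym (toℕ-incr (lookup μ i) (proj₂ rp))) (ℕ.s≤s ℕ.z≤n)) e
    where
    rp : (1 ℕ.≤ toℕ (lookup μ i)) × (toℕ (lookup μ i) ℕ.< p)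
    rp = raisable-bounds (lookup μ i) h

  lowerAt-Γ : (i : Fin n) (ν : Tuple n p) → lowerable (lookup ν i) ≡ true → InΓ q ν → InΓ q (lowerAt i ν)
  lowerAt-Γ i ν h e = update-Γ ν i _ (NP.≤-trans (ℕ.s≤s ℕ.z≤n) l2) (subst (1 ℕ.≤_) (sym (toℕ-decr (lookup ν i))) (pred≥1 (toℕ (lookup ν i)) l2)) e
    where
    l2 : 2 ℕ.≤ toℕ (lookup ν i)
    l2 = lowerable-bound (lookup ν i) h
    pred≥1 : ∀ k → 2 ℕ.≤ k → 1 ℕ.≤ ℕ.pred k
    pred≥1 (suc (suc k)) _ = ℕ.s≤s ℕ.z≤n
    pred≥1 (suc zero) (ℕ.s≤s ())

  ∑-raises-from : (i : Fin n) (μ : Tuple n p) → InΓ q μ → (g : Tuple n p → ℚ) →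
        ∑ (Γ n p q) (λ ν → χ (raises i μ ν) * g ν) ≡ χ (raisable (lookup μ i)) * g (raiseAt i μ)
  ∑-raises-from i μ μΓ g = trans (∑-cong (Γ n p q) (λ ν → trans (cong (λ z → χ z * g ν) (raises⇔raiseAt i μ ν))
                   (trans (cong (_* g ν) (χ-∧ (raisable (lookup μ i)) (ν =V raiseAt i μ))) (QP.*-assoc (χ (raisable (lookup μ i))) (χ
                       (ν =V raiseAt i μ)) (g ν)))))
                  (trans (∑-*ˡ (Γ n p q) (χ (raisable (lookup μ i))) (λ ν → χ (ν =V raiseAt i μ) * g ν)) (by-raisable (raisable (lookup μ i)) refl))
    where
    by-raisable : (r : Bool) → raisable (lookup μ i) ≡ r → χ r * ∑ (Γ n p q) (λ ν → χ (ν =V raiseAt i μ) * g ν) ≡ χ r * g (raiseAt i μ)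
    by-raisable true e = cong (1ℚ *_) (∑Γ-point (raiseAt i μ) (raiseAt-Γ i μ e μΓ) g)
    by-raisable false e = trans (QP.*-zeroˡ (∑ (Γ n p q) (λ ν → χ (ν =V raiseAt i μ) * g ν))) (sym (QP.*-zeroˡ (g (raiseAt i μ))))

  ∑-raises-into : (i : Fin n) (ν : Tuple n p) → InΓ q ν → (g : Tuple n p → ℚ) →
        ∑ (Γ n p q) (λ μ → χ (raises i μ ν) * g μ) ≡ χ (lowerable (lookup ν i)) * g (lowerAt i ν)
  ∑-raises-into i ν νΓ g = trans (∑-cong (Γ n p q) (λ μ → trans (cong (λ z → χ z * g μ) (raises⇔lowerAt i μ ν))
                   (trans (cong (_* g μ) (χ-∧ (lowerable (lookup ν i)) (μ =V lowerAt i ν))) (QP.*-assoc (χ (lowerable (lookup ν i))) (χ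
                       (μ =V lowerAt i ν)) (g μ)))))
                  (trans (∑-*ˡ (Γ n p q) (χ (lowerable (lookup ν i))) (λ μ → χ (μ =V lowerAt i ν) * g μ)) (by-lowerable (lowerable (lookup ν i)) refl))
    where
    by-lowerable : (r : Bool) → lowerable (lookup ν i) ≡ r → χ r * ∑ (Γ n p q) (λ μ → χ (μ =V lowerAt i ν) * g μ) ≡ χ r * g (lowerAt i ν)
    by-lowerable true e = cong (1ℚ *_) (∑Γ-point (lowerAt i ν) (lowerAt-Γ i ν e νΓ) g)
    by-lowerable false e = trans (QP.*-zeroˡ (∑ (Γ n p q) (λ μ → χ (μ =V lowerAt i ν) * g μ))) (sym (QP.*-zeroˡ (g (lowerAt i ν))))

module _ {n p : ℕ} where
  level-raiseAt : (i : Fin n) (μ : Tuple n p) → raisable (lookup μ i) ≡ true → level (raiseAt i μ) ≡ suc (level μ)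
  level-raiseAt i μ h = NP.+-cancelʳ-≡ (ℕ.pred t) _ _ (trans (stat-update excess μ i (incr (lookup μ i)))
     (trans (cong (λ z → level μ ℕ.+ ℕ.pred z) (toℕ-incr (lookup μ i) (proj₂ rp)))
       (trans (cong (level μ ℕ.+_) (sym (NP.suc-pred t {{ℕ.>-nonZero (proj₁ rp)}}))) (NP.+-suc (level μ) (ℕ.pred t)))))
    where
    rp : (1 ℕ.≤ toℕ (lookup μ i)) × (toℕ (lookup μ i) ℕ.< p)
    rp = raisable-bounds (lookup μ i) h
    t : ℕ
    t = toℕ (lookup μ i)

  level-lowerAt : (i : Fin n) (ν : Tuple n p) → lowerable (lookup ν i) ≡ true → suc (level (lowerAt i ν)) ≡ level ν
  level-lowerAt i ν h = NP.+-cancelʳ-≡ (ℕ.pred (ℕ.pred t)) _ _ (trans (sym (NP.+-suc (level (lowerAt i ν)) (ℕ.pred (ℕ.pred t))))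
     (trans (cong (level (lowerAt i ν) ℕ.+_) (suc-pred-pred t (lowerable-bound (lookup ν i) h)))
       (trans (stat-update excess ν i (decr (lookup ν i))) (cong (λ z → level ν ℕ.+ ℕ.pred z) (toℕ-decr (lookup ν i))))))
    where
    t : ℕ
    t = toℕ (lookup ν i)
    suc-pred-pred : ∀ k → 2 ℕ.≤ k → suc (ℕ.pred (ℕ.pred k)) ≡ ℕ.pred k
    suc-pred-pred (suc (suc k)) _ = refl
    suc-pred-pred (suc zero) (ℕ.s≤s ())

lowerableWeight : {p : ℕ} → Fin (suc p) → ℕ
lowerableWeight v = if lowerable v then 1 else 0

level-pos⇒lowerable : {m p : ℕ} (μ : Tuple m p) → 1 ℕ.≤ level μ → 1 ℕ.≤ stat lowerableWeight μ
level-pos⇒lowerable (a ∷ μ) h with lowerable a in e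
... | true = ℕ.s≤s ℕ.z≤n
... | false = level-pos⇒lowerable μ (subst (1 ℕ.≤_) (cong (ℕ._+ level μ) (≱2⇒pred≡0 (toℕ a) (λ h2 → case trans (sym e) (⌊⌋-true⇐
    (2 ℕ.≤? toℕ a) h2) of λ ()))) h)
  where
  ≱2⇒pred≡0 : ∀ t → ¬ (2 ℕ.≤ t) → ℕ.pred t ≡ 0
  ≱2⇒pred≡0 zero _ = refl
  ≱2⇒pred≡0 (suc zero) _ = refl
  ≱2⇒pred≡0 (suc (suc t)) ne = ⊥-elim (ne (ℕ.s≤s (ℕ.s≤s ℕ.z≤n)))

sameContent : {n p : ℕ} → Tuple n p → Tuple n p → Bool
sameContent x ν = ⌊ VP.≡-dec ℕ._≟_ (content ν) (content x) ⌋

-- Balance of the flow across a content class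

module Flow {n p q : ℕ} (π : Tuple n p → Poly) (stationary : IsStationary n p q π) (a b : ℕ) where
  coeffAt : Tuple n p → ℚ
  coeffAt μ = coeff (π μ) a b
  coeffBelow : Tuple n p → ℚ
  coeffBelow μ = shiftedCoeff (π μ) 1 0 a b
  swapFlow : Fin n → Tuple n p → Tuple n p → ℚ
  swapFlow k μ ν = coeff (π μ *P swapRate k μ ν) a b
  changeFlow : Fin n → Tuple n p → Tuple n p → ℚ
  changeFlow k μ ν = χ (raises k μ ν) * coeffBelow μ + χ (raises k ν μ) * coeffAt μ
  flow : Tuple n p → Tuple n p → ℚ
  flow μ ν = coeff (π μ *P rate μ ν) a b

  G : List (Tuple n p)
  G = Γ n p q
  allF : List (Fin n)
  allF = List.allFin n

  flow-split : (μ ν : Tuple n p) → flow μ ν ≡ ∑ allF (λ k → swapFlow k μ ν + changeFlow k μ ν)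
  flow-split μ ν = trans (coeff-*-sumP (π μ) allF (λ k → swapRate k μ ν +P changeRate k μ ν) a b)
     (∑-cong allF (λ k → trans (coeff-*-++ (π μ) (swapRate k μ ν) (changeRate k μ ν) a b) (cong (swapFlow k μ ν +_) (coeff-*-changeRate (π μ) k μ ν a b))))

  flow-diag : (ν : Tuple n p) → flow ν ν ≡ 0ℚ
  flow-diag ν = trans (flow-split ν ν) (∑-zero allF (λ k → swapFlow k ν ν + changeFlow k ν ν) (λ k _ → trans (cong₂ _+_ (coeff-*-swapRate-diag (π ν) a b k ν)
      (cong (λ z → χ z * coeffBelow ν + χ z * coeffAt ν) (raises-irrefl k ν))) (trans (QP.+-identityˡ
          (χ false * coeffBelow ν + χ false * coeffAt ν)) (trans (cong₂ _+_ (QP.*-zeroˡ (coeffBelow ν)) (QP.*-zeroˡ (coeffAt ν))) (QP.+-identityˡ 0ℚ)))))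

  3n : ℚ
  3n = (ℤ.+ (3 ℕ.* n)) Q./ 1

  outflow : Tuple n p → ℚ
  outflow μ = ∑ G (λ ν → flow μ ν)
  inflow : Tuple n p → ℚ
  inflow ν = ∑ G (λ μ → flow μ ν)

  coeff-*-W : (μ ν : Tuple n p) → coeff (π μ *P W n p q μ ν) a b ≡ χ (μ =V ν) * (3n * coeffAt μ - outflow μ) + χ (not (μ =V ν)) * flow μ ν
  coeff-*-W μ ν with μ =V ν
  ... | true = trans (coeff-*-++ (π μ) (constℕ (3 ℕ.* n)) (negP (sumP G (rate μ))) a b)
       (trans (cong₂ _+_ (trans (coeff-*-termʳ (π μ) 0 0 3n a b) (cong (3n *_) (shiftedCoeff-0-0 (π μ) a b)))
                         (trans (coeff-*-negP (π μ) (sumP G (rate μ)) a b) (cong -_ (coeff-*-sumP (π μ) G (rate μ) a b))))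
        (sym (trans (cong₂ _+_ (QP.*-identityˡ (3n * coeffAt μ - outflow μ)) (QP.*-zeroˡ (flow μ ν))) (QP.+-identityʳ (3n * coeffAt μ - outflow μ)))))
  ... | false = sym (trans (cong₂ _+_ (QP.*-zeroˡ (3n * coeffAt μ - outflow μ)) (QP.*-identityˡ (flow μ ν))) (QP.+-identityˡ (flow μ ν)))

  inflow≡outflow : (ν : Tuple n p) → InΓ q ν → inflow ν ≡ outflow ν
  inflow≡outflow ν νΓ = x-y+z≡x⇒z≡y (3n * coeffAt ν) (outflow ν) (inflow ν) (trans (sym eq1) eq2)
    where
    open ≡-Reasoning
    notsplit : ∑ G (λ μ → χ (not (μ =V ν)) * flow μ ν) ≡ inflow ν
    notsplit = begin
      ∑ G (λ μ → χ (not (μ =V ν)) * flow μ ν)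
        ≡⟨ ∑-cong G (λ μ → trans (cong (_* flow μ ν) (χ-not (μ =V ν))) (solve 2 (λ c r → (con 1ℚ :- c) :* r := r :- c :* r) refl (χ (μ =V ν)) (flow μ ν))) ⟩
      ∑ G (λ μ → flow μ ν - χ (μ =V ν) * flow μ ν)
        ≡⟨ ∑-sub G (λ μ → flow μ ν) (λ μ → χ (μ =V ν) * flow μ ν) ⟩
      inflow ν - ∑ G (λ μ → χ (μ =V ν) * flow μ ν)
        ≡⟨ cong (λ z → inflow ν - z) (trans (∑Γ-point ν νΓ (λ μ → flow μ ν)) (flow-diag ν)) ⟩
      inflow ν - 0ℚ
        ≡⟨ solve 1 (λ x → x :- con 0ℚ := x) refl (inflow ν) ⟩
      inflow ν ∎
    eq1 : coeff (sumP G (λ μ → π μ *P W n p q μ ν)) a b ≡ 3n * coeffAt ν - outflow ν + inflow ν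
    eq1 = begin
      coeff (sumP G (λ μ → π μ *P W n p q μ ν)) a b
        ≡⟨ coeff-sumP G (λ μ → π μ *P W n p q μ ν) a b ⟩
      ∑ G (λ μ → coeff (π μ *P W n p q μ ν) a b)
        ≡⟨ ∑-cong G (λ μ → coeff-*-W μ ν) ⟩
      ∑ G (λ μ → χ (μ =V ν) * (3n * coeffAt μ - outflow μ) + χ (not (μ =V ν)) * flow μ ν)
        ≡⟨ ∑-+ G (λ μ → χ (μ =V ν) * (3n * coeffAt μ - outflow μ)) (λ μ → χ (not (μ =V ν)) * flow μ ν) ⟩
      ∑ G (λ μ → χ (μ =V ν) * (3n * coeffAt μ - outflow μ)) + ∑ G (λ μ → χ (not (μ =V ν)) * flow μ ν)
        ≡⟨ cong₂ _+_ (∑Γ-point ν νΓ (λ μ → 3n * coeffAt μ - outflow μ)) notsplit ⟩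
      3n * coeffAt ν - outflow ν + inflow ν ∎
    eq2 : coeff (sumP G (λ μ → π μ *P W n p q μ ν)) a b ≡ 3n * coeffAt ν
    eq2 = trans (stationary ν νΓ a b) (trans (coeff-term-* 0 0 3n (π ν) a b) (cong (3n *_) (shiftedCoeff-0-0 (π ν) a b)))

  module ClassBalance (x : Tuple n p) where
    inClass : Tuple n p → ℚ
    inClass ν = χ (sameContent x ν)
    raiseGain : Tuple n p → ℚ
    raiseGain μ = ∑ allF (λ k → χ (raisable (lookup μ k)) * (inClass (raiseAt k μ) - inClass μ))
    lowerGain : Tuple n p → ℚ
    lowerGain μ = ∑ allF (λ k → χ (lowerable (lookup μ k)) * (inClass (lowerAt k μ) - inClass μ))

    inClass-cong : (ν μ : Tuple n p) → content ν ≡ content μ → inClass ν ≡ inClass μ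
    inClass-cong ν μ e = cong (λ c → χ ⌊ VP.≡-dec ℕ._≟_ c (content x) ⌋) e

    swap-flow-within : (k : Fin n) (μ ν : Tuple n p) → (inClass ν - inClass μ) * swapFlow k μ ν ≡ 0ℚ
    swap-flow-within k μ ν with VP.≡-dec ℕ._≟_ (content ν) (content μ)
    ... | yes e = trans (cong (_* swapFlow k μ ν) (trans (cong (_- inClass μ) (inClass-cong ν μ e)) (QP.+-inverseʳ (inClass μ)))) (QP.*-zeroˡ (swapFlow k μ ν))
    ... | no ne = trans (cong ((inClass ν - inClass μ) *_) (coeff-*-swapRate-across (π μ) a b k μ ν ne)) (QP.*-zeroʳ (inClass ν - inClass μ))

    flow-term : (k : Fin n) (μ ν : Tuple n p) → (inClass ν - inClass μ) * (swapFlow k μ ν + changeFlow k μ ν) ≡ coeffBelow μ * (χ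
        (raises k μ ν) * (inClass ν - inClass μ)) + coeffAt μ * (χ (raises k ν μ) * (inClass ν - inClass μ))
    flow-term k μ ν = trans (QP.*-distribˡ-+ (inClass ν - inClass μ) (swapFlow k μ ν) (changeFlow k μ ν))
      (trans (cong (_+ (inClass ν - inClass μ) * changeFlow k μ ν) (swap-flow-within k μ ν)) (trans (QP.+-identityˡ _)
        (solve 5 (λ d k1 k2 fu f → d :* (k1 :* fu :+ k2 :* f) := fu :* (k1 :* d) :+ f :* (k2 :* d)) refl (inClass ν - inClass μ) (χ
            (raises k μ ν)) (χ (raises k ν μ)) (coeffBelow μ) (coeffAt μ))))

    flow-against-class : (μ : Tuple n p) → InΓ q μ → ∑ G (λ ν → (inClass ν - inClass μ) * flow μ ν) ≡ coeffBelow μ * raiseGain μ + coeffAt μ * lowerGain μ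
    flow-against-class μ μΓ = begin
      ∑ G (λ ν → (inClass ν - inClass μ) * flow μ ν)
        ≡⟨ ∑-cong G (λ ν → trans (cong ((inClass ν - inClass μ) *_) (flow-split μ ν)) (trans (sym (∑-*ˡ allF (inClass ν - inClass μ)
            (λ k → swapFlow k μ ν + changeFlow k μ ν)))
             (∑-cong allF (λ k → flow-term k μ ν)))) ⟩
      ∑ G (λ ν → ∑ allF (λ k → coeffBelow μ * (χ (raises k μ ν) * (inClass ν - inClass μ)) + coeffAt μ * (χ (raises k ν μ) * (inClass ν - inClass μ))))
        ≡⟨ ∑-comm G allF (λ ν k → coeffBelow μ * (χ (raises k μ ν) * (inClass ν - inClass μ)) + coeffAt μ * (χ (raises k ν μ) * (inClass ν - inClass μ))) ⟩
      ∑ allF (λ k → ∑ G (λ ν → coeffBelow μ * (χ (raises k μ ν) * (inClass ν - inClass μ)) + coeffAt μ * (χ (raises k ν μ) * (inClass ν - inClass μ))))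
        ≡⟨ ∑-cong allF (λ k → trans (∑-+ G (λ ν → coeffBelow μ * (χ (raises k μ ν) * (inClass ν - inClass μ))) (λ ν → coeffAt μ * (χ
            (raises k ν μ) * (inClass ν - inClass μ))))
              (cong₂ _+_ (trans (∑-*ˡ G (coeffBelow μ) (λ ν → χ (raises k μ ν) * (inClass ν - inClass μ))) (cong (coeffBelow μ *_)
                  (∑-raises-from k μ μΓ (λ ν → inClass ν - inClass μ))))
                         (trans (∑-*ˡ G (coeffAt μ) (λ ν → χ (raises k ν μ) * (inClass ν - inClass μ))) (cong (coeffAt μ *_)
                             (∑-raises-into k μ μΓ (λ ν → inClass ν - inClass μ)))))) ⟩
      ∑ allF (λ k → coeffBelow μ * (χ (raisable (lookup μ k)) * (inClass (raiseAt k μ) - inClass μ)) + coeffAt μ * (χ (lowerable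
          (lookup μ k)) * (inClass (lowerAt k μ) - inClass μ)))
        ≡⟨ ∑-+ allF _ _ ⟩
      ∑ allF (λ k → coeffBelow μ * (χ (raisable (lookup μ k)) * (inClass (raiseAt k μ) - inClass μ))) + ∑ allF (λ k → coeffAt μ * (χ
          (lowerable (lookup μ k)) * (inClass (lowerAt k μ) - inClass μ)))
        ≡⟨ cong₂ _+_ (∑-*ˡ allF (coeffBelow μ) _) (∑-*ˡ allF (coeffAt μ) _) ⟩
      coeffBelow μ * raiseGain μ + coeffAt μ * lowerGain μ ∎
      where open ≡-Reasoning

    -- Σ π(μ) rate(μ,ν) (1ₓ(ν) − 1ₓ(μ)) is inflow minus outflow of the class, hence zero; swaps
    -- never change the class, so only the change moves contribute.
    class-balance : ∑ G (λ μ → coeffBelow μ * raiseGain μ + coeffAt μ * lowerGain μ) ≡ 0ℚ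
    class-balance = begin
      ∑ G (λ μ → coeffBelow μ * raiseGain μ + coeffAt μ * lowerGain μ)
        ≡⟨ ∑Γ-cong (λ μ μΓ → sym (flow-against-class μ μΓ)) ⟩
      ∑ G (λ μ → ∑ G (λ ν → (inClass ν - inClass μ) * flow μ ν))
        ≡⟨ ∑-cong G (λ μ → trans (∑-cong G (λ ν → QP.*-distribʳ-+ (flow μ ν) (inClass ν) (- inClass μ))) (∑-+ G _ _)) ⟩
      ∑ G (λ μ → ∑ G (λ ν → inClass ν * flow μ ν) + ∑ G (λ ν → (- inClass μ) * flow μ ν))
        ≡⟨ ∑-+ G _ _ ⟩
      ∑ G (λ μ → ∑ G (λ ν → inClass ν * flow μ ν)) + ∑ G (λ μ → ∑ G (λ ν → (- inClass μ) * flow μ ν))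
        ≡⟨ cong₂ _+_ (∑-comm G G (λ μ ν → inClass ν * flow μ ν)) (∑-cong G (λ μ → ∑-*ˡ G (- inClass μ) (λ ν → flow μ ν))) ⟩
      ∑ G (λ ν → ∑ G (λ μ → inClass ν * flow μ ν)) + ∑ G (λ μ → (- inClass μ) * outflow μ)
        ≡⟨ cong (_+ ∑ G (λ μ → (- inClass μ) * outflow μ)) (∑-cong G (λ ν → ∑-*ˡ G (inClass ν) (λ μ → flow μ ν))) ⟩
      ∑ G (λ ν → inClass ν * inflow ν) + ∑ G (λ μ → (- inClass μ) * outflow μ)
        ≡⟨ cong (_+ ∑ G (λ μ → (- inClass μ) * outflow μ)) (∑Γ-cong (λ ν νΓ → cong (inClass ν *_) (inflow≡outflow ν νΓ))) ⟩
      ∑ G (λ ν → inClass ν * outflow ν) + ∑ G (λ μ → (- inClass μ) * outflow μ)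
        ≡⟨ sym (∑-+ G _ _) ⟩
      ∑ G (λ ν → inClass ν * outflow ν + (- inClass ν) * outflow ν)
        ≡⟨ ∑-zero G _ (λ ν _ → trans (sym (QP.*-distribʳ-+ (outflow ν) (inClass ν) (- inClass ν))) (trans (cong (_* outflow ν)
            (QP.+-inverseʳ (inClass ν))) (QP.*-zeroˡ (outflow ν)))) ⟩
      0ℚ ∎
      where open ≡-Reasoning

-- Averaging over content classes

countTrue : {A : Set} → List A → (A → Bool) → ℕ
countTrue [] f = 0
countTrue (x ∷ L) f = (if f x then 1 else 0) ℕ.+ countTrue L f

fromℕ-if : (b : Bool) → fromℕ (if b then 1 else 0) ≡ χ b
fromℕ-if true = refl
fromℕ-if false = refl

∑χ≡countTrue : {A : Set} (L : List A) (f : A → Bool) → ∑ L (λ x → χ (f x)) ≡ fromℕ (countTrue L f)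
∑χ≡countTrue [] f = refl
∑χ≡countTrue (x ∷ L) f = trans (cong₂ _+_ (sym (fromℕ-if (f x))) (∑χ≡countTrue L f)) (sym (fromℕ-+ (if f x then 1 else 0) (countTrue L f)))

countTrue-mono : {A : Set} (L : List A) (f g : A → Bool) → (∀ x → f x ≡ true → g x ≡ true) → countTrue L f ℕ.≤ countTrue L g
countTrue-mono [] f g h = ℕ.z≤n
countTrue-mono (x ∷ L) f g h with f x in e
... | true rewrite h x e = ℕ.s≤s (countTrue-mono L f g h)
... | false = NP.≤-trans (countTrue-mono L f g h) (NP.m≤n+m (countTrue L g) _)

fromℕ≢0 : (k : ℕ) → 1 ℕ.≤ k → ¬ (fromℕ k ≡ 0ℚ)
fromℕ≢0 (suc k) _ ()

module ClassSums {n p q : ℕ} where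
  G : List (Tuple n p)
  G = Γ n p q
  allF : List (Fin n)
  allF = List.allFin n

  memberOf : Tuple n p → Tuple n p → ℚ
  memberOf y μ = χ (sameContent y μ)

  classSize : Tuple n p → ℚ
  classSize y = ∑ G (memberOf y)

  classSum : Tuple n p → (Tuple n p → ℚ) → ℚ
  classSum y h = ∑ G (λ μ → memberOf y μ * h μ)

  sameContent⇒ : (y μ : Tuple n p) → sameContent y μ ≡ true → content μ ≡ content y
  sameContent⇒ y μ h = ⌊⌋-true⇒ (VP.≡-dec ℕ._≟_ (content μ) (content y)) h

  sameContent⇐ : (y μ : Tuple n p) → content μ ≡ content y → sameContent y μ ≡ true
  sameContent⇐ y μ e = ⌊⌋-true⇐ (VP.≡-dec ℕ._≟_ (content μ) (content y)) e

  sameContent-sym : (y μ : Tuple n p) → sameContent y μ ≡ sameContent μ y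
  sameContent-sym y μ = Bool-ext (λ h → sameContent⇐ μ y (sym (sameContent⇒ y μ h))) (λ h → sameContent⇐ y μ (sym (sameContent⇒ μ y h)))

  sameContent-cong : (y y2 μ : Tuple n p) → content y ≡ content y2 → sameContent y μ ≡ sameContent y2 μ
  sameContent-cong y y2 μ e = cong (λ c → ⌊ VP.≡-dec ℕ._≟_ (content μ) c ⌋) e

  classSize-cong : (y y2 : Tuple n p) → content y ≡ content y2 → classSize y ≡ classSize y2
  classSize-cong y y2 e = ∑-cong G (λ μ → cong χ (sameContent-cong y y2 μ e))

  classSize≢0 : (y : Tuple n p) → InΓ q y → ¬ (classSize y ≡ 0ℚ)
  classSize≢0 y yΓ = fromℕ≢0 _ (NP.≤-trans y-counted (countTrue-mono G (λ μ → μ =V y) (sameContent y) (λ μ h → sameContent⇐ y μ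
      (cong content (=V⇒≡ h))))) ∘ sym ∘ (λ e → trans (sym e) (∑χ≡countTrue G (sameContent y))) 
    where
    y-counted : 1 ℕ.≤ countTrue G (λ μ → μ =V y)
    y-counted = NP.≤-reflexive (sym (fromℕ-injective (trans (sym (∑χ≡countTrue G (λ μ → μ =V y))) (trans (∑-cong G (λ μ → sym
        (QP.*-identityʳ (χ (μ =V y))))) (∑Γ-point y yΓ (λ _ → 1ℚ))))))

  class-averaging : (w : Tuple n p → ℚ) → (∀ μ ν → content μ ≡ content ν → w μ ≡ w ν) → (h : Tuple n p → ℚ) (cc : ℚ) →
       (∀ y → InΓ q y → (w y ≡ 0ℚ) ⊎ (classSum y h ≡ cc * classSize y)) → ∑ G (λ μ → w μ * h μ) ≡ cc * ∑ G w
  class-averaging w w-invariant h cc alternative = begin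
      ∑ G (λ μ → w μ * h μ)
        ≡⟨ ∑-cong G (λ μ → solve 3 (λ w h c → w :* h := w :* (h :- c) :+ c :* w) refl (w μ) (h μ) cc) ⟩
      ∑ G (λ μ → w μ * deviation μ + cc * w μ)
        ≡⟨ ∑-+ G (λ μ → w μ * deviation μ) (λ μ → cc * w μ) ⟩
      ∑ G (λ μ → w μ * deviation μ) + ∑ G (λ μ → cc * w μ)
        ≡⟨ cong₂ _+_ ∑-w*deviation≡0 (∑-*ˡ G cc w) ⟩
      0ℚ + cc * ∑ G w
        ≡⟨ QP.+-identityˡ (cc * ∑ G w) ⟩
      cc * ∑ G w ∎
    where
    open ≡-Reasoning
    deviation : Tuple n p → ℚ
    deviation μ = h μ - cc
    deviation-vanishes : ∀ y → InΓ q y → w y * classSum y deviation ≡ 0ℚ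
    deviation-vanishes y yΓ with alternative y yΓ
    ... | inj₁ e = trans (cong (_* classSum y deviation) e) (QP.*-zeroˡ (classSum y deviation))
    ... | inj₂ e = trans (cong (w y *_) (trans (∑-cong G (λ μ → QP.*-distribˡ-+ (memberOf y μ) (h μ) (- cc)))
                      (trans (∑-+ G (λ μ → memberOf y μ * h μ) (λ μ → memberOf y μ * - cc)) (trans (cong₂ _+_ e (trans (∑-*ʳ G (- cc)
                          (memberOf y)) refl)) (solve 2 (λ c classSize → c :* classSize :+ classSize :* (:- c) := con 0ℚ) refl cc (classSize y))))))
                    (QP.*-zeroʳ (w y))
    w-redistributed : ∀ μ → InΓ q μ → ∑ G (λ ν → w ν * inv (classSize ν) * memberOf ν μ) ≡ w μ
    w-redistributed μ μΓ = begin
      ∑ G (λ ν → w ν * inv (classSize ν) * memberOf ν μ)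
        ≡⟨ ∑-cong G pt ⟩
      ∑ G (λ ν → w μ * inv (classSize μ) * memberOf μ ν)
        ≡⟨ ∑-*ˡ G (w μ * inv (classSize μ)) (memberOf μ) ⟩
      w μ * inv (classSize μ) * classSize μ
        ≡⟨ trans (QP.*-assoc (w μ) (inv (classSize μ)) (classSize μ)) (trans (cong (w μ *_) (inv-inverseˡ (classSize μ) (classSize≢0 μ μΓ)))
            (QP.*-identityʳ (w μ))) ⟩
      w μ ∎
      where
      pt : ∀ ν → w ν * inv (classSize ν) * memberOf ν μ ≡ w μ * inv (classSize μ) * memberOf μ ν
      pt ν with sameContent ν μ in e
      ... | true = trans (cong₂ (λ a b → a * inv b * 1ℚ) (w-invariant ν μ (sym (sameContent⇒ ν μ e))) (classSize-cong ν μ (sym (sameContent⇒ ν μ e))))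
                     (cong (λ z → w μ * inv (classSize μ) * χ z) (sym (trans (sym (sameContent-sym ν μ)) e)))
      ... | false = trans (QP.*-zeroʳ (w ν * inv (classSize ν))) (trans (sym (QP.*-zeroʳ (w μ * inv (classSize μ)))) (cong (λ z → w μ * inv
          (classSize μ) * χ z) (sym (trans (sym (sameContent-sym ν μ)) e))))
    ∑-w*deviation≡0 : ∑ G (λ μ → w μ * deviation μ) ≡ 0ℚ
    ∑-w*deviation≡0 = begin
      ∑ G (λ μ → w μ * deviation μ)
        ≡⟨ ∑Γ-cong (λ μ μΓ → trans (cong (_* deviation μ) (sym (w-redistributed μ μΓ))) (sym (∑-*ʳ G (deviation μ) (λ ν → w ν * inv
            (classSize ν) * memberOf ν μ)))) ⟩
      ∑ G (λ μ → ∑ G (λ ν → w ν * inv (classSize ν) * memberOf ν μ * deviation μ))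
        ≡⟨ ∑-comm G G (λ μ ν → w ν * inv (classSize ν) * memberOf ν μ * deviation μ) ⟩
      ∑ G (λ ν → ∑ G (λ μ → w ν * inv (classSize ν) * memberOf ν μ * deviation μ))
        ≡⟨ ∑-cong G (λ ν → trans (∑-cong G (λ μ → solve 4 (λ a b c d → a :* b :* c :* d := (b :* a) :* (c :* d)) refl (w ν) (inv
            (classSize ν)) (memberOf ν μ) (deviation μ)))
                               (∑-*ˡ G (inv (classSize ν) * w ν) (λ μ → memberOf ν μ * deviation μ))) ⟩
      ∑ G (λ ν → inv (classSize ν) * w ν * classSum ν deviation)
        ≡⟨ ∑Γ-zero _ (λ ν νΓ → trans (QP.*-assoc (inv (classSize ν)) (w ν) (classSum ν deviation)) (trans (cong (inv (classSize ν) *_)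
            (deviation-vanishes ν νΓ)) (QP.*-zeroʳ (inv (classSize ν))))) ⟩
      0ℚ ∎

suc-≟-suc-ℕ : (x y : ℕ) → ⌊ suc x ℕ.≟ suc y ⌋ ≡ ⌊ x ℕ.≟ y ⌋
suc-≟-suc-ℕ x y with suc x ℕ.≟ suc y | x ℕ.≟ y
... | yes _ | yes _ = refl
... | no _ | no _ = refl
... | yes e | no ne = ⊥-elim (ne (NP.suc-injective e))
... | no ne | yes e = ⊥-elim (ne (cong suc e))

suc-≟-0 : (x : ℕ) → ⌊ suc x ℕ.≟ 0 ⌋ ≡ false
suc-≟-0 x with suc x ℕ.≟ 0
... | no _ = refl

+-≟-+ : (L e a : ℕ) → ⌊ L ℕ.+ e ℕ.≟ L ℕ.+ a ⌋ ≡ ⌊ e ℕ.≟ a ⌋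
+-≟-+ zero e a = refl
+-≟-+ (suc L) e a = trans (suc-≟-suc-ℕ (L ℕ.+ e) (L ℕ.+ a)) (+-≟-+ L e a)

big-≟ : (L e a : ℕ) → a ℕ.< L → ⌊ L ℕ.+ e ℕ.≟ a ⌋ ≡ false
big-≟ (suc L) e zero h = suc-≟-0 (L ℕ.+ e)
big-≟ (suc L) e (suc a) h = trans (suc-≟-suc-ℕ (L ℕ.+ e) a) (big-≟ L e a (ℕ.s≤s⁻¹ h))

-- Class sums, by induction on the u-degree and the level

neg-suc-pred : ∀ d → 0 ℕ.< d → ℤ.- (ℤ.+ d) ≡ -[1+ ℕ.pred d ]
neg-suc-pred (suc d) _ = refl

isLevel0 : {n p : ℕ} → Tuple n p → ℚ
isLevel0 μ = χ ⌊ level μ ℕ.≟ 0 ⌋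

level0Count : (n p q : ℕ) → ℚ
level0Count n p q = ∑ (Γ n p q) isLevel0

levelZeroAverage : {n p q : ℕ} → (Tuple n p → Poly) → Poly
levelZeroAverage {n} {p} {q} π = constℚ (inv (level0Count n p q)) *P sumP (Γ n p q) (λ μ → constℚ (isLevel0 μ) *P π μ)

module DegreeInduction {n p q : ℕ} (π : Tuple n p → Poly) (stationary : IsStationary n p q π) (b : ℕ) where
  open ClassSums {n} {p} {q}

  N₀ : ℚ
  N₀ = level0Count n p q

  basePoly : Poly
  basePoly = levelZeroAverage {n} {p} {q} π

  -- Exponents of u are shifted by levels, so they are integers; negative ones give 0.
  coeffℤ : Poly → ℤ → ℚ
  coeffℤ P (ℤ.+ a) = coeff P a b
  coeffℤ P -[1+ _ ] = 0ℚ

  coeffOf : Tuple n p → ℤ → ℚ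
  coeffOf μ z = coeffℤ (π μ) z

  relCoeff : ℤ → Tuple n p → ℚ
  relCoeff k μ = coeffOf μ (ℤ.+ level μ ℤ.+ k)

  shiftedCoeff-ℤ : (P : Poly) (L a : ℕ) → shiftedCoeff P L 0 a b ≡ coeffℤ P (ℤ.+ a ℤ.- ℤ.+ L)
  shiftedCoeff-ℤ P L a with L ℕ.≤? a
  ... | yes h = trans (subst (λ a2 → shiftedCoeff P L 0 a2 b ≡ coeff P (a ℕ.∸ L) b) (NP.m+[n∸m]≡n h)
                  (trans (∑-cong P (λ t → cong (λ z → χ (z ∧ ⌊ tDeg t ℕ.≟ b ⌋) * coef t) (+-≟-+ L (uDeg t) (a ℕ.∸ L)))) (sym (coeff-as-∑ P (a ℕ.∸ L) b))))
                  (sym (cong (coeffℤ P) (trans (ZP.[+m]-[+n]≡m⊖n a L) (ZP.⊖-≥ h))))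
  ... | no h = trans (∑-zero P _ (λ t _ → trans (cong (λ z → χ (z ∧ ⌊ tDeg t ℕ.≟ b ⌋) * coef t) (big-≟ L (uDeg t) a (NP.≰⇒> h))) (QP.*-zeroˡ (coef t))))
                 (sym (cong (coeffℤ P) (trans (ZP.[+m]-[+n]≡m⊖n a L) (trans (ZP.⊖-< (NP.≰⇒> h)) (neg-suc-pred (L ℕ.∸ a) (NP.m<n⇒0<n∸m (NP.≰⇒> h)))))))

  baseCoeff : ℤ → ℚ
  baseCoeff k = coeffℤ basePoly k

  coeff-basePoly : (j : ℕ) → coeff basePoly j b ≡ inv N₀ * ∑ G (λ μ → isLevel0 μ * coeff (π μ) j b)
  coeff-basePoly j = trans (coeff-term-* 0 0 (inv N₀) (sumP G (λ μ → constℚ (isLevel0 μ) *P π μ)) j b) (cong (inv N₀ *_) (trans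
      (shiftedCoeff-0-0 (sumP G (λ μ → constℚ (isLevel0 μ) *P π μ)) j b) (trans (coeff-sumP G (λ μ → constℚ (isLevel0 μ) *P π μ) j b)
     (∑-cong G (λ μ → trans (coeff-term-* 0 0 (isLevel0 μ) (π μ) j b) (cong (isLevel0 μ *_) (shiftedCoeff-0-0 (π μ) j b)))))))

  ClassSumsAt : ℤ → Set
  ClassSumsAt k = ∀ y → InΓ q y → classSum y (relCoeff k) ≡ baseCoeff k * classSize y

  level-sameContent : (y μ : Tuple n p) → sameContent y μ ≡ true → level μ ≡ level y
  level-sameContent y μ h = stat-content-invariant μ y (sameContent⇒ y μ h) excess

  classSum-level0 : (k : ℤ) (y : Tuple n p) → InΓ q y → level y ≡ 0 → classSum y (relCoeff k) ≡ baseCoeff k * classSize y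
  classSum-level0 k y yΓ ly = trans classSum≡level0Sum (trans (level0Sum≡baseCoeff*N₀ k) (cong (baseCoeff k *_) (sym classSize≡N₀)))
    where
    memberOf≡isLevel0 : ∀ μ → InΓ q μ → memberOf y μ ≡ isLevel0 μ
    memberOf≡isLevel0 μ μΓ = cong χ (Bool-ext (λ h → ⌊⌋-true⇐ (level μ ℕ.≟ 0) (trans (level-sameContent y μ h) ly))
                               (λ h → sameContent⇐ y μ (level0-content-unique μ y μΓ yΓ (⌊⌋-true⇒ (level μ ℕ.≟ 0) h) ly)))
    classSize≡N₀ : classSize y ≡ N₀
    classSize≡N₀ = ∑Γ-cong memberOf≡isLevel0
    classSum≡level0Sum : classSum y (relCoeff k) ≡ ∑ G (λ μ → isLevel0 μ * coeffOf μ k)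
    classSum≡level0Sum = ∑Γ-cong (λ μ μΓ → trans (cong (_* relCoeff k μ) (memberOf≡isLevel0 μ μΓ)) (level0-relCoeff μ))
      where
      level0-relCoeff : ∀ μ → isLevel0 μ * relCoeff k μ ≡ isLevel0 μ * coeffOf μ k
      level0-relCoeff μ with level μ ℕ.≟ 0
      ... | yes e = cong (λ z → 1ℚ * coeffOf μ z) (trans (cong (λ l → ℤ.+ l ℤ.+ k) e) (ZP.+-identityˡ k))
      ... | no _ = trans (QP.*-zeroˡ (relCoeff k μ)) (sym (QP.*-zeroˡ (coeffOf μ k)))
    N₀≢0 : ¬ (N₀ ≡ 0ℚ)
    N₀≢0 e = classSize≢0 y yΓ (trans classSize≡N₀ e)
    level0Sum≡baseCoeff*N₀ : ∀ k → ∑ G (λ μ → isLevel0 μ * coeffOf μ k) ≡ baseCoeff k * N₀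
    level0Sum≡baseCoeff*N₀ (ℤ.+ j) = sym (trans (cong (_* N₀) (coeff-basePoly j)) (trans (solve 3 (λ i s m → i :* s :* m := s :* (i :* m)) refl (inv N₀) sm N₀)
                     (trans (cong (sm *_) (inv-inverseˡ N₀ N₀≢0)) (QP.*-identityʳ sm))))
      where sm = ∑ G (λ μ → isLevel0 μ * coeff (π μ) j b)
    level0Sum≡baseCoeff*N₀ -[1+ j ] = trans (∑-zero G _ (λ μ _ → QP.*-zeroʳ (isLevel0 μ))) (sym (QP.*-zeroˡ N₀))

  1+L+k≡a⇒a-1≡L+k : (L : ℕ) (k : ℤ) (a : ℕ) → ℤ.+ suc L ℤ.+ k ≡ ℤ.+ a → ℤ.+ a ℤ.- ℤ.+ 1 ≡ ℤ.+ L ℤ.+ k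
  1+L+k≡a⇒a-1≡L+k L k a e = trans (cong (ℤ._- ℤ.+ 1) (sym e)) (trans (cong (λ z → (z ℤ.+ k) ℤ.- ℤ.+ 1) (ZP.pos-+ 1 L))
     (ZS.solve 2 (λ l k → (ZS.con (ℤ.+ 1) ZS.:+ l ZS.:+ k) ZS.:- ZS.con (ℤ.+ 1) ZS.:= l ZS.:+ k) refl (ℤ.+ L) k))

  1+L+k≡a⇒a-1≡1+L+[k-1] : (L : ℕ) (k : ℤ) (a : ℕ) → ℤ.+ suc L ℤ.+ k ≡ ℤ.+ a → ℤ.+ a ℤ.- ℤ.+ 1 ≡ ℤ.+ suc L ℤ.+ (k ℤ.- ℤ.+ 1)
  1+L+k≡a⇒a-1≡1+L+[k-1] L k a e = trans (cong (ℤ._- ℤ.+ 1) (sym e))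
     (ZS.solve 2 (λ l k → (l ZS.:+ k) ZS.:- ZS.con (ℤ.+ 1) ZS.:= l ZS.:+ (k ZS.:- ZS.con (ℤ.+ 1))) refl (ℤ.+ suc L) k)

  1+L+k≡a⇒a≡2+L+[k-1] : (L : ℕ) (k : ℤ) (a : ℕ) → ℤ.+ suc L ℤ.+ k ≡ ℤ.+ a → ℤ.+ a ≡ ℤ.+ suc (suc L) ℤ.+ (k ℤ.- ℤ.+ 1)
  1+L+k≡a⇒a≡2+L+[k-1] L k a e = trans (sym e) (trans (ZS.solve 2 (λ l k → l ZS.:+ k ZS.:= (ZS.con (ℤ.+ 1) ZS.:+ l) ZS.:+ (k ZS.:- ZS.con
      (ℤ.+ 1))) refl (ℤ.+ suc L) k)
     (cong (ℤ._+ (k ℤ.- ℤ.+ 1)) (sym (ZP.pos-+ 1 (suc L)))))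

  module LevelStep (k : ℤ) (previousDegree : ClassSumsAt (k ℤ.- ℤ.+ 1)) (L : ℕ)
              (lowerLevel : ∀ y → InΓ q y → level y ≡ L → classSum y (relCoeff k) ≡ baseCoeff k * classSize y)
              (x : Tuple n p) (xΓ : InΓ q x) (lx : level x ≡ suc L) where
    raiseInto : Tuple n p → ℚ
    raiseInto μ = ∑ allF (λ j → χ (raisable (lookup μ j)) * memberOf x (raiseAt j μ))
    raisableCount : Tuple n p → ℚ
    raisableCount μ = ∑ allF (λ j → χ (raisable (lookup μ j)))
    lowerInto : Tuple n p → ℚ
    lowerInto μ = ∑ allF (λ j → χ (lowerable (lookup μ j)) * memberOf x (lowerAt j μ))
    lowerableCount : Tuple n p → ℚ
    lowerableCount μ = ∑ allF (λ j → χ (lowerable (lookup μ j)))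

    raiseIntoBy : Vec ℕ (suc p) → Fin (suc p) → ℚ
    raiseIntoBy c v = χ (raisable v) * χ ⌊ VP.≡-dec ℕ._≟_ (moveContent c v (incr v)) (content x) ⌋
    lowerIntoBy : Vec ℕ (suc p) → Fin (suc p) → ℚ
    lowerIntoBy c v = χ (lowerable v) * χ ⌊ VP.≡-dec ℕ._≟_ (moveContent c v (decr v)) (content x) ⌋

    raiseInto-by : ∀ μ → raiseInto μ ≡ ∑ allF (λ j → raiseIntoBy (content μ) (lookup μ j))
    raiseInto-by μ = ∑-cong allF (λ j → cong (λ c → χ (raisable (lookup μ j)) * χ ⌊ VP.≡-dec ℕ._≟_ c (content x) ⌋) (content-update μ j (incr (lookup μ j))))
    lowerInto-by : ∀ μ → lowerInto μ ≡ ∑ allF (λ j → lowerIntoBy (content μ) (lookup μ j))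
    lowerInto-by μ = ∑-cong allF (λ j → cong (λ c → χ (lowerable (lookup μ j)) * χ ⌊ VP.≡-dec ℕ._≟_ c (content x) ⌋) (content-update μ j (decr (lookup μ j))))

    raiseInto-invariant : ∀ μ ν → content μ ≡ content ν → raiseInto μ ≡ raiseInto ν
    raiseInto-invariant μ ν e = trans (raiseInto-by μ) (trans (∑-cong allF (λ j → cong (λ c → raiseIntoBy c (lookup μ j)) e)) (trans
        (∑-content-invariant μ ν e (raiseIntoBy (content ν))) (sym (raiseInto-by ν))))
    lowerInto-invariant : ∀ μ ν → content μ ≡ content ν → lowerInto μ ≡ lowerInto ν
    lowerInto-invariant μ ν e = trans (lowerInto-by μ) (trans (∑-cong allF (λ j → cong (λ c → lowerIntoBy c (lookup μ j)) e)) (trans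
        (∑-content-invariant μ ν e (lowerIntoBy (content ν))) (sym (lowerInto-by ν))))

    raisableCount-class : ∀ μ → sameContent x μ ≡ true → raisableCount μ ≡ raisableCount x
    raisableCount-class μ h = ∑-content-invariant μ x (sameContent⇒ x μ h) (λ v → χ (raisable v))
    lowerableCount-class : ∀ μ → sameContent x μ ≡ true → lowerableCount μ ≡ lowerableCount x
    lowerableCount-class μ h = ∑-content-invariant μ x (sameContent⇒ x μ h) (λ v → χ (lowerable v))

    lowerableCount≢0 : ¬ (lowerableCount x ≡ 0ℚ)
    lowerableCount≢0 e = fromℕ≢0 (stat lowerableWeight x) (level-pos⇒lowerable x (subst (1 ℕ.≤_) (sym lx) (ℕ.s≤s ℕ.z≤n)))
      (trans (fromℕ-stat lowerableWeight x) (trans (∑-cong allF (λ j → fromℕ-if (lowerable (lookup x j)))) e))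

    ∑-raiseInto : ∑ G raiseInto ≡ lowerableCount x * classSize x
    ∑-raiseInto = begin
      ∑ G raiseInto
        ≡⟨ ∑Γ-cong (λ μ μΓ → ∑-cong allF (λ j → sym (∑-raises-from j μ μΓ (memberOf x)))) ⟩
      ∑ G (λ μ → ∑ allF (λ j → ∑ G (λ ν → χ (raises j μ ν) * memberOf x ν)))
        ≡⟨ ∑-comm G allF _ ⟩
      ∑ allF (λ j → ∑ G (λ μ → ∑ G (λ ν → χ (raises j μ ν) * memberOf x ν)))
        ≡⟨ ∑-cong allF (λ j → ∑-comm G G _) ⟩
      ∑ allF (λ j → ∑ G (λ ν → ∑ G (λ μ → χ (raises j μ ν) * memberOf x ν)))
        ≡⟨ ∑-cong allF (λ j → ∑Γ-cong (λ ν νΓ → trans (∑-*ʳ G (memberOf x ν) (λ μ → χ (raises j μ ν)))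
              (cong (_* memberOf x ν) (trans (∑-cong G (λ μ → sym (QP.*-identityʳ (χ (raises j μ ν))))) (trans (∑-raises-into j ν νΓ
                  (λ _ → 1ℚ)) (QP.*-identityʳ (χ (lowerable (lookup ν j))))))))) ⟩
      ∑ allF (λ j → ∑ G (λ ν → χ (lowerable (lookup ν j)) * memberOf x ν))
        ≡⟨ ∑-comm allF G _ ⟩
      ∑ G (λ ν → ∑ allF (λ j → χ (lowerable (lookup ν j)) * memberOf x ν))
        ≡⟨ ∑-cong G (λ ν → trans (∑-*ʳ allF (memberOf x ν) _) (QP.*-comm (lowerableCount ν) (memberOf x ν))) ⟩
      ∑ G (λ ν → memberOf x ν * lowerableCount ν)
        ≡⟨ ∑-cong G (λ ν → lowerableCount-on-class ν) ⟩
      ∑ G (λ ν → lowerableCount x * memberOf x ν)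
        ≡⟨ ∑-*ˡ G (lowerableCount x) (memberOf x) ⟩
      lowerableCount x * classSize x ∎
      where
      open ≡-Reasoning
      lowerableCount-on-class : ∀ ν → memberOf x ν * lowerableCount ν ≡ lowerableCount x * memberOf x ν
      lowerableCount-on-class ν with sameContent x ν in e
      ... | true = trans (cong (1ℚ *_) (lowerableCount-class ν e)) (QP.*-comm 1ℚ (lowerableCount x))
      ... | false = trans (QP.*-zeroˡ (lowerableCount ν)) (sym (QP.*-zeroʳ (lowerableCount x)))

    ∑-lowerInto : ∑ G lowerInto ≡ raisableCount x * classSize x
    ∑-lowerInto = begin
      ∑ G lowerInto
        ≡⟨ ∑Γ-cong (λ μ μΓ → ∑-cong allF (λ j → sym (∑-raises-into j μ μΓ (memberOf x)))) ⟩
      ∑ G (λ μ → ∑ allF (λ j → ∑ G (λ ν → χ (raises j ν μ) * memberOf x ν)))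
        ≡⟨ ∑-comm G allF _ ⟩
      ∑ allF (λ j → ∑ G (λ μ → ∑ G (λ ν → χ (raises j ν μ) * memberOf x ν)))
        ≡⟨ ∑-cong allF (λ j → ∑-comm G G _) ⟩
      ∑ allF (λ j → ∑ G (λ ν → ∑ G (λ μ → χ (raises j ν μ) * memberOf x ν)))
        ≡⟨ ∑-cong allF (λ j → ∑Γ-cong (λ ν νΓ → trans (∑-*ʳ G (memberOf x ν) (λ μ → χ (raises j ν μ)))
              (cong (_* memberOf x ν) (trans (∑-cong G (λ μ → sym (QP.*-identityʳ (χ (raises j ν μ))))) (trans (∑-raises-from j ν νΓ
                  (λ _ → 1ℚ)) (QP.*-identityʳ (χ (raisable (lookup ν j))))))))) ⟩
      ∑ allF (λ j → ∑ G (λ ν → χ (raisable (lookup ν j)) * memberOf x ν))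
        ≡⟨ ∑-comm allF G _ ⟩
      ∑ G (λ ν → ∑ allF (λ j → χ (raisable (lookup ν j)) * memberOf x ν))
        ≡⟨ ∑-cong G (λ ν → trans (∑-*ʳ allF (memberOf x ν) _) (QP.*-comm (raisableCount ν) (memberOf x ν))) ⟩
      ∑ G (λ ν → memberOf x ν * raisableCount ν)
        ≡⟨ ∑-cong G (λ ν → raisableCount-on-class ν) ⟩
      ∑ G (λ ν → raisableCount x * memberOf x ν)
        ≡⟨ ∑-*ˡ G (raisableCount x) (memberOf x) ⟩
      raisableCount x * classSize x ∎
      where
      open ≡-Reasoning
      raisableCount-on-class : ∀ ν → memberOf x ν * raisableCount ν ≡ raisableCount x * memberOf x ν
      raisableCount-on-class ν with sameContent x ν in e
      ... | true = trans (cong (1ℚ *_) (raisableCount-class ν e)) (QP.*-comm 1ℚ (raisableCount x))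
      ... | false = trans (QP.*-zeroˡ (raisableCount ν)) (sym (QP.*-zeroʳ (raisableCount x)))

    negative-degree : (m : ℕ) → ℤ.+ suc L ℤ.+ k ≡ -[1+ m ] → classSum x (relCoeff k) ≡ baseCoeff k * classSize x
    negative-degree m ez = trans (∑Γ-zero _ pt) (sym (czn k ez))
      where
      pt : ∀ μ → InΓ q μ → memberOf x μ * relCoeff k μ ≡ 0ℚ
      pt μ _ with sameContent x μ in e
      ... | true = trans (QP.*-identityˡ (relCoeff k μ)) (trans (cong (λ l → coeffOf μ (ℤ.+ l ℤ.+ k)) (trans (level-sameContent x μ e) lx))
          (cong (coeffOf μ) ez))
      ... | false = QP.*-zeroˡ (relCoeff k μ)
      czn : ∀ k → ℤ.+ suc L ℤ.+ k ≡ -[1+ m ] → baseCoeff k * classSize x ≡ 0ℚ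
      czn -[1+ j ] _ = QP.*-zeroˡ (classSize x)

    module NonNegDegree (a : ℕ) (ez : ℤ.+ suc L ℤ.+ k ≡ ℤ.+ a) where
      module FlowAB = Flow π stationary a b
      module Balance = FlowAB.ClassBalance x

      k-1 : ℤ
      k-1 = k ℤ.- ℤ.+ 1

      raiseGain-split : ∀ μ → Balance.raiseGain μ ≡ raiseInto μ - memberOf x μ * raisableCount μ
      raiseGain-split μ = trans (∑-cong allF (λ j → solve 3 (λ r u c → r :* (u :- c) := r :* u :- c :* r) refl (χ (raisable (lookup μ j)))
          (memberOf x (raiseAt j μ)) (memberOf x μ)))
        (trans (∑-sub allF (λ j → χ (raisable (lookup μ j)) * memberOf x (raiseAt j μ)) (λ j → memberOf x μ * χ (raisable (lookup μ j))))
            (cong (λ z → raiseInto μ - z) (∑-*ˡ allF (memberOf x μ) _)))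
      lowerGain-split : ∀ μ → Balance.lowerGain μ ≡ lowerInto μ - memberOf x μ * lowerableCount μ
      lowerGain-split μ = trans (∑-cong allF (λ j → solve 3 (λ r u c → r :* (u :- c) := r :* u :- c :* r) refl (χ (lowerable (lookup μ j)))
          (memberOf x (lowerAt j μ)) (memberOf x μ)))
        (trans (∑-sub allF (λ j → χ (lowerable (lookup μ j)) * memberOf x (lowerAt j μ)) (λ j → memberOf x μ * χ (lowerable (lookup μ j))))
            (cong (λ z → lowerInto μ - z) (∑-*ˡ allF (memberOf x μ) _)))

      coeffBelow-level : ∀ μ → level μ ≡ L → FlowAB.coeffBelow μ ≡ relCoeff k μ
      coeffBelow-level μ e = trans (shiftedCoeff-ℤ (π μ) 1 a) (cong (coeffOf μ) (trans (1+L+k≡a⇒a-1≡L+k L k a ez) (cong (λ l → ℤ.+ l ℤ.+ k) (sym e))))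
      coeffBelow-level+1 : ∀ μ → level μ ≡ suc L → FlowAB.coeffBelow μ ≡ relCoeff k-1 μ
      coeffBelow-level+1 μ e = trans (shiftedCoeff-ℤ (π μ) 1 a) (cong (coeffOf μ) (trans (1+L+k≡a⇒a-1≡1+L+[k-1] L k a ez) (cong (λ l → ℤ.+ l ℤ.+ k-1) (sym e))))
      coeffAt-level+2 : ∀ μ → level μ ≡ suc (suc L) → FlowAB.coeffAt μ ≡ relCoeff k-1 μ
      coeffAt-level+2 μ e = cong (coeffOf μ) (trans (1+L+k≡a⇒a≡2+L+[k-1] L k a ez) (cong (λ l → ℤ.+ l ℤ.+ k-1) (sym e)))
      coeffAt-level+1 : ∀ μ → level μ ≡ suc L → FlowAB.coeffAt μ ≡ relCoeff k μ
      coeffAt-level+1 μ e = cong (coeffOf μ) (trans (sym ez) (cong (λ l → ℤ.+ l ℤ.+ k) (sym e)))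

      raiseInto-term : ∀ μ → FlowAB.coeffBelow μ * raiseInto μ ≡ raiseInto μ * relCoeff k μ
      raiseInto-term μ = trans (sym (∑-*ˡ allF (FlowAB.coeffBelow μ) _)) (trans (∑-cong allF (λ j → χ∧χ-transport (raisable (lookup μ j))
          (sameContent x (raiseAt j μ)) (FlowAB.coeffBelow μ) (relCoeff k μ)
               (λ h₁ h₂ → coeffBelow-level μ (NP.suc-injective (trans (sym (level-raiseAt j μ h₁)) (trans (level-sameContent x (raiseAt j μ) h₂) lx))))))
               (∑-*ʳ allF (relCoeff k μ) _))
      raisable-term : ∀ μ → FlowAB.coeffBelow μ * (memberOf x μ * raisableCount μ) ≡ raisableCount x * (memberOf x μ * relCoeff k-1 μ)
      raisable-term μ = χ-transport (sameContent x μ) (FlowAB.coeffBelow μ) (relCoeff k-1 μ) (raisableCount μ) (raisableCount x) (λ e →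
          coeffBelow-level+1 μ (trans (level-sameContent x μ e) lx) , raisableCount-class μ e)
      lowerInto-term : ∀ μ → FlowAB.coeffAt μ * lowerInto μ ≡ lowerInto μ * relCoeff k-1 μ
      lowerInto-term μ = trans (sym (∑-*ˡ allF (FlowAB.coeffAt μ) _)) (trans (∑-cong allF (λ j → χ∧χ-transport (lowerable (lookup μ j))
          (sameContent x (lowerAt j μ)) (FlowAB.coeffAt μ) (relCoeff k-1 μ)
               (λ h₁ h₂ → coeffAt-level+2 μ (trans (sym (level-lowerAt j μ h₁)) (cong suc (trans (level-sameContent x (lowerAt j μ) h₂) lx))))))
               (∑-*ʳ allF (relCoeff k-1 μ) _))
      lowerable-term : ∀ μ → FlowAB.coeffAt μ * (memberOf x μ * lowerableCount μ) ≡ lowerableCount x * (memberOf x μ * relCoeff k μ)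
      lowerable-term μ = χ-transport (sameContent x μ) (FlowAB.coeffAt μ) (relCoeff k μ) (lowerableCount μ) (lowerableCount x) (λ e →
          coeffAt-level+1 μ (trans (level-sameContent x μ e) lx) , lowerableCount-class μ e)

      raiseInto-alternative : ∀ y → InΓ q y → (raiseInto y ≡ 0ℚ) ⊎ (classSum y (relCoeff k) ≡ baseCoeff k * classSize y)
      raiseInto-alternative y yΓ with level y ℕ.≟ L
      ... | yes e = inj₂ (lowerLevel y yΓ e)
      ... | no ne = inj₁ (∑-zero allF _ (λ j _ → no-raise-into-x j))
        where
        no-raise-into-x : ∀ j → χ (raisable (lookup y j)) * memberOf x (raiseAt j y) ≡ 0ℚ
        no-raise-into-x j with raisable (lookup y j) in h₁ | sameContent x (raiseAt j y) in h₂
        ... | true | true = ⊥-elim (ne (NP.suc-injective (trans (sym (level-raiseAt j y h₁)) (trans (level-sameContent x (raiseAt j y) h₂) lx))))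
        ... | true | false = QP.*-zeroʳ 1ℚ
        ... | false | w = QP.*-zeroˡ (χ w)

      ∑-raiseInto-term : ∑ G (λ μ → FlowAB.coeffBelow μ * raiseInto μ) ≡ baseCoeff k * (lowerableCount x * classSize x)
      ∑-raiseInto-term = trans (∑-cong G raiseInto-term) (trans (class-averaging raiseInto raiseInto-invariant (relCoeff k)
          (baseCoeff k) raiseInto-alternative) (cong (baseCoeff k *_) ∑-raiseInto))
      ∑-raisable-term : ∑ G (λ μ → FlowAB.coeffBelow μ * (memberOf x μ * raisableCount μ)) ≡ raisableCount x * (baseCoeff k-1 * classSize x)
      ∑-raisable-term = trans (∑-cong G raisable-term) (trans (∑-*ˡ G (raisableCount x) _) (cong (raisableCount x *_) (previousDegree x xΓ)))
      ∑-lowerInto-term : ∑ G (λ μ → FlowAB.coeffAt μ * lowerInto μ) ≡ baseCoeff k-1 * (raisableCount x * classSize x)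
      ∑-lowerInto-term = trans (∑-cong G lowerInto-term) (trans (class-averaging lowerInto lowerInto-invariant (relCoeff k-1)
          (baseCoeff k-1) (λ y yΓ → inj₂ (previousDegree y yΓ))) (cong (baseCoeff k-1 *_) ∑-lowerInto))
      ∑-lowerable-term : ∑ G (λ μ → FlowAB.coeffAt μ * (memberOf x μ * lowerableCount μ)) ≡ lowerableCount x * classSum x (relCoeff k)
      ∑-lowerable-term = trans (∑-cong G lowerable-term) (∑-*ˡ G (lowerableCount x) _)

      gain-split : ∀ μ → FlowAB.coeffBelow μ * Balance.raiseGain μ + FlowAB.coeffAt μ * Balance.lowerGain μ ≡ (FlowAB.coeffBelow μ *
          raiseInto μ - FlowAB.coeffBelow μ * (memberOf x μ * raisableCount
          μ)) + (FlowAB.coeffAt μ * lowerInto μ - FlowAB.coeffAt μ * (memberOf x μ * lowerableCount μ))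
      gain-split μ = trans (cong₂ (λ u d → FlowAB.coeffBelow μ * u + FlowAB.coeffAt μ * d) (raiseGain-split μ) (lowerGain-split μ))
        (solve 6 (λ fu f wu wd a d → fu :* (wu :- a) :+ f :* (wd :- d) := (fu :* wu :- fu :* a) :+ (f :* wd :- f :* d)) refl
          (FlowAB.coeffBelow μ) (FlowAB.coeffAt μ) (raiseInto μ) (lowerInto μ) (memberOf x μ * raisableCount μ) (memberOf x μ * lowerableCount μ))

      -- The four sums of the class balance: raising into x from level L (degree k), raising
      -- out of x and lowering into x from level L + 2 (degree k − 1), lowering out of x
      -- (degree k, the unknown class sum).
      balance-at-x : lowerableCount x * (baseCoeff k * classSize x - classSum x (relCoeff k)) ≡ 0ℚ
      balance-at-x = begin
        lowerableCount x * (baseCoeff k * classSize x - classSum x (relCoeff k))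
          ≡⟨ solve 6 (λ c c1 nl nr nn s → nl :* (c :* nn :- s) := (c :* (nl :* nn) :- nr :* (c1 :* nn)) :+ (c1 :* (nr :* nn) :- nl :* s)) refl
               (baseCoeff k) (baseCoeff k-1) (lowerableCount x) (raisableCount x) (classSize x) (classSum x (relCoeff k)) ⟩
        (baseCoeff k * (lowerableCount x * classSize x) - raisableCount x * (baseCoeff k-1 * classSize x)) + (baseCoeff k-1 *
            (raisableCount x * classSize x) - lowerableCount x * classSum x (relCoeff k))
          ≡⟨ sym (cong₂ _+_ (cong₂ _-_ ∑-raiseInto-term ∑-raisable-term) (cong₂ _-_ ∑-lowerInto-term ∑-lowerable-term)) ⟩
        (∑ G (λ μ → FlowAB.coeffBelow μ * raiseInto μ) - ∑ G (λ μ → FlowAB.coeffBelow μ * (memberOf x μ * raisableCount μ))) + (∑ G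
            (λ μ → FlowAB.coeffAt μ * lowerInto μ) - ∑ G (λ μ → FlowAB.coeffAt μ * (memberOf x μ * lowerableCount μ)))
          ≡⟨ sym (cong₂ _+_ (∑-sub G _ _) (∑-sub G _ _)) ⟩
        ∑ G (λ μ → FlowAB.coeffBelow μ * raiseInto μ - FlowAB.coeffBelow μ *
            (memberOf x μ * raisableCount μ)) + ∑ G (λ μ → FlowAB.coeffAt μ * lowerInto μ - FlowAB.coeffAt μ * (memberOf x μ * lowerableCount μ))
          ≡⟨ sym (∑-+ G _ _) ⟩
        ∑ G (λ μ → (FlowAB.coeffBelow μ * raiseInto μ - FlowAB.coeffBelow μ * (memberOf x μ * raisableCount μ)) +
            (FlowAB.coeffAt μ * lowerInto μ - FlowAB.coeffAt μ * (memberOf x μ * lowerableCount μ)))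
          ≡⟨ sym (∑-cong G gain-split) ⟩
        ∑ G (λ μ → FlowAB.coeffBelow μ * Balance.raiseGain μ + FlowAB.coeffAt μ * Balance.lowerGain μ)
          ≡⟨ Balance.class-balance ⟩
        0ℚ ∎
        where open ≡-Reasoning

      classSum-x : classSum x (relCoeff k) ≡ baseCoeff k * classSize x
      classSum-x = x-y≡0⇒y≡x (baseCoeff k * classSize x) (classSum x (relCoeff k)) (*-cancel-≢0 (lowerableCount x) _ lowerableCount≢0 balance-at-x)

    result : classSum x (relCoeff k) ≡ baseCoeff k * classSize x
    result with ℤ.+ suc L ℤ.+ k in ez
    ... | -[1+ m ] = negative-degree m ez
    ... | ℤ.+ a = NonNegDegree.classSum-x a ez

  classSumsAt-step : (k : ℤ) → ClassSumsAt (k ℤ.- ℤ.+ 1) → ClassSumsAt k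
  classSumsAt-step k IH y yΓ = go (level y) y yΓ refl
    where
    go : ∀ L y → InΓ q y → level y ≡ L → classSum y (relCoeff k) ≡ baseCoeff k * classSize y
    go zero y yΓ e = classSum-level0 k y yΓ e
    go (suc L) y yΓ e = LevelStep.result k IH L (go L) y yΓ e

  maxLevel : ℕ
  maxLevel = n ℕ.* p

  level≤n*p : {m : ℕ} (μ : Tuple m p) → level μ ℕ.≤ m ℕ.* p
  level≤n*p [] = ℕ.z≤n
  level≤n*p (a ∷ μ) = NP.+-mono-≤ (NP.≤-trans (NP.pred-mono-≤ (FP.toℕ≤pred[n] a)) (NP.pred[n]≤n {p})) (level≤n*p μ)

  classSumsAt-low : ClassSumsAt -[1+ maxLevel ]
  classSumsAt-low y yΓ = trans (∑Γ-zero _ (λ μ _ → trans (cong (memberOf y μ *_) (relCoeff-low≡0 μ)) (QP.*-zeroʳ (memberOf y μ)))) (sym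
      (QP.*-zeroˡ (classSize y)))
    where
    relCoeff-low≡0 : ∀ μ → relCoeff -[1+ maxLevel ] μ ≡ 0ℚ
    relCoeff-low≡0 μ = cong (coeffOf μ) (trans (ZP.m-n≡m⊖n (level μ) (suc maxLevel)) (trans (ZP.⊖-< (ℕ.s≤s (level≤n*p μ))) (neg-suc-pred
        (suc maxLevel ℕ.∸ level μ) (NP.m<n⇒0<n∸m (ℕ.s≤s (level≤n*p μ))))))

  classSumsAt-from-low : (d : ℕ) → ClassSumsAt (-[1+ maxLevel ] ℤ.+ ℤ.+ d)
  classSumsAt-from-low zero = subst ClassSumsAt (sym (ZP.+-identityʳ -[1+ maxLevel ])) classSumsAt-low
  classSumsAt-from-low (suc d) = classSumsAt-step (-[1+ maxLevel ] ℤ.+ ℤ.+ suc d) (subst ClassSumsAt eq (classSumsAt-from-low d))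
    where
    eq : -[1+ maxLevel ] ℤ.+ ℤ.+ d ≡ (-[1+ maxLevel ] ℤ.+ ℤ.+ suc d) ℤ.- ℤ.+ 1
    eq = trans (ZS.solve 2 (λ x y → x ZS.:+ y ZS.:= (x ZS.:+ (ZS.con (ℤ.+ 1) ZS.:+ y)) ZS.:- ZS.con (ℤ.+ 1)) refl -[1+ maxLevel ] (ℤ.+ d))
               (cong (λ z → (-[1+ maxLevel ] ℤ.+ z) ℤ.- ℤ.+ 1) (sym (ZP.pos-+ 1 d)))

  classSumsAt-all : (a L : ℕ) → L ℕ.≤ maxLevel → ClassSumsAt (ℤ.+ a ℤ.- ℤ.+ L)
  classSumsAt-all a L h = subst ClassSumsAt eq (classSumsAt-from-low (a ℕ.+ r))
    where
    r : ℕ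
    r = suc maxLevel ℕ.∸ L
    lr : L ℕ.+ r ≡ suc maxLevel
    lr = NP.m+[n∸m]≡n (NP.m≤n⇒m≤1+n h)
    eq : -[1+ maxLevel ] ℤ.+ ℤ.+ (a ℕ.+ r) ≡ ℤ.+ a ℤ.- ℤ.+ L
    eq = trans (cong₂ ℤ._+_ (cong (λ z → ℤ.- (ℤ.+ z)) (sym lr)) (ZP.pos-+ a r))
           (trans (cong (λ z → ℤ.- z ℤ.+ (ℤ.+ a ℤ.+ ℤ.+ r)) (ZP.pos-+ L r))
             (ZS.solve 3 (λ l r a → ZS.:- (l ZS.:+ r) ZS.:+ (a ZS.:+ r) ZS.:= a ZS.:- l) refl (ℤ.+ L) (ℤ.+ r) (ℤ.+ a)))

  classSum-coeff : (x : Tuple n p) → InΓ q x → (a : ℕ) →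
    classSum x (λ μ → coeff (π μ) a b) ≡ classSize x * shiftedCoeff basePoly (level x) 0 a b
  classSum-coeff x xΓ a = begin
      classSum x (λ μ → coeff (π μ) a b)
        ≡⟨ ∑-cong G coeff≡relCoeff ⟩
      classSum x (relCoeff k)
        ≡⟨ classSumsAt-all a (level x) (level≤n*p x) x xΓ ⟩
      baseCoeff k * classSize x
        ≡⟨ QP.*-comm (baseCoeff k) (classSize x) ⟩
      classSize x * baseCoeff k
        ≡⟨ cong (classSize x *_) (sym (shiftedCoeff-ℤ basePoly (level x) a)) ⟩
      classSize x * shiftedCoeff basePoly (level x) 0 a b ∎
    where
    open ≡-Reasoning
    k : ℤ
    k = ℤ.+ a ℤ.- ℤ.+ level x
    coeff≡relCoeff : ∀ μ → memberOf x μ * coeff (π μ) a b ≡ memberOf x μ * relCoeff k μ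
    coeff≡relCoeff μ with sameContent x μ in e
    ... | false = trans (QP.*-zeroˡ (coeff (π μ) a b)) (sym (QP.*-zeroˡ (relCoeff k μ)))
    ... | true = cong (λ z → 1ℚ * coeffOf μ z) (sym (trans (cong (λ l → ℤ.+ l ℤ.+ k) (level-sameContent x μ e))
                   (ZS.solve 2 (λ l a → l ZS.:+ (a ZS.:- l) ZS.:= a) refl (ℤ.+ level x) (ℤ.+ a))))

-- Orbit sums

module _ {n p : ℕ} where
  count-∉ : (O : List (Tuple n p)) (μ : Tuple n p) → ¬ (μ ∈ O) → ∑ O (λ y → χ (μ =V y)) ≡ 0ℚ
  count-∉ [] μ h = refl
  count-∉ (y ∷ O) μ h = trans (cong₂ _+_ (cong χ (≢⇒=V-false (λ e → h (here e)))) (count-∉ O μ (λ m → h (there m)))) (QP.+-identityˡ 0ℚ)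

  count-∈ : (O : List (Tuple n p)) → Unique O → (μ : Tuple n p) → μ ∈ O → ∑ O (λ y → χ (μ =V y)) ≡ 1ℚ
  count-∈ (y ∷ O) (px AP.∷ u) μ (here refl) = trans (cong₂ _+_ (cong χ (=V-refl μ)) (count-∉ O μ (λ m → All.lookup px m refl))) (QP.+-identityʳ 1ℚ)
  count-∈ (y ∷ O) (px AP.∷ u) μ (there m) = trans (cong₂ _+_ (cong χ (≢⇒=V-false (λ e → All.lookup px (subst (_∈ O) e m) refl)))
      (count-∈ O u μ m)) (QP.+-identityˡ 1ℚ)

  length-as-∑ : (O : List (Tuple n p)) → fromℕ (length O) ≡ ∑ O (λ _ → 1ℚ)
  length-as-∑ [] = refl
  length-as-∑ (y ∷ O) = trans (fromℕ-suc (length O)) (cong (1ℚ +_) (length-as-∑ O))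

module OrbitSum {n p q : ℕ} (x : Tuple n p) (xΓ : InΓ q x) (O : List (Tuple n p)) (unique : Unique O)
                (orbit : ∀ y → (y ∈ O) ⇔ InOrbit x y) where
  open ClassSums {n} {p} {q}

  orbit-Γ : ∀ y → y ∈ O → InΓ q y
  orbit-Γ y m = trans (nonzeroCount-stat y) (trans (stat-content-invariant y x (orbit⇒content x y (Equivalence.to (orbit y) m)) isNonzero)
      (trans (sym (nonzeroCount-stat x)) xΓ))

  orbit-sum : (g : Tuple n p → ℚ) → ∑ O g ≡ classSum x g
  orbit-sum g = begin
      ∑ O g
        ≡⟨ ∑-cong-∈ O (λ y m → sym (∑Γ-point y (orbit-Γ y m) g)) ⟩
      ∑ O (λ y → ∑ G (λ μ → χ (μ =V y) * g μ))
        ≡⟨ ∑-comm O G _ ⟩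
      ∑ G (λ μ → ∑ O (λ y → χ (μ =V y) * g μ))
        ≡⟨ ∑-cong G (λ μ → trans (∑-*ʳ O (g μ) (λ y → χ (μ =V y))) (cong (_* g μ) (multiplicity-in-O μ))) ⟩
      classSum x g ∎
    where
    open ≡-Reasoning
    multiplicity-in-O : ∀ μ → ∑ O (λ y → χ (μ =V y)) ≡ memberOf x μ
    multiplicity-in-O μ with sameContent x μ in e
    ... | true = count-∈ O unique μ (Equivalence.from (orbit μ) (content⇒orbit x μ (sameContent⇒ x μ e)))
    ... | false = count-∉ O μ (λ m → case trans (sym e) (sameContent⇐ x μ (orbit⇒content x μ (Equivalence.to (orbit μ) m))) of λ ())

  length≡classSize : fromℕ (length O) ≡ classSize x
  length≡classSize = trans (length-as-∑ O) (trans (orbit-sum (λ _ → 1ℚ)) (∑-cong G (λ μ → QP.*-identityʳ (memberOf x μ))))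

orbit-average : (n p q : ℕ) (π : Tuple n p → Poly) → IsStationary n p q π →
  (x : Tuple n p) → InΓ q x → (O : List (Tuple n p)) → Unique O → (∀ y → (y ∈ O) ⇔ InOrbit x y) →
  sumP O π ≈ constℕ (length O) *P (monomial (level x) 0 *P levelZeroAverage {n} {p} {q} π)
orbit-average n p q π stationary x xΓ O unique orbit a b = begin
    coeff (sumP O π) a b
      ≡⟨ coeff-sumP O π a b ⟩
    ∑ O (λ y → coeff (π y) a b)
      ≡⟨ orbit-sum (λ y → coeff (π y) a b) ⟩
    classSum x (λ y → coeff (π y) a b)
      ≡⟨ classSum-coeff x xΓ a ⟩
    classSize x * shiftedCoeff (levelZeroAverage {n} {p} {q} π) (level x) 0 a b
      ≡⟨ cong (_* shiftedCoeff (levelZeroAverage {n} {p} {q} π) (level x) 0 a b) (sym length≡classSize) ⟩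
    fromℕ (length O) * shiftedCoeff (levelZeroAverage {n} {p} {q} π) (level x) 0 a b
      ≡⟨ sym (coeff-constℕ-*-monomial (length O) (level x) 0 (levelZeroAverage {n} {p} {q} π) a b) ⟩
    coeff (constℕ (length O) *P (monomial (level x) 0 *P levelZeroAverage {n} {p} {q} π)) a b ∎
  where
  open ≡-Reasoning
  open ClassSums {n} {p} {q}
  open OrbitSum x xΓ O unique orbit
  open DegreeInduction π stationary b

corollary5p4 : (n p q : ℕ) → 1 ≤ p → 1 ≤ q → q < n →
    (π : Tuple n p → Poly) → IsStationary n p q π → GCDOne n p q π →
    Σ Poly λ c → (x : Tuple n p) → InΓ q x →
    (O : List (Tuple n p)) → Unique O → (∀ y → (y ∈ O) ⇔ InOrbit x y) →
    Σ ℕ λ eu → Σ ℕ λ et →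
    sumP O π ≈ constℕ (length O) *P (monomial eu et *P c)
corollary5p4 n p q _ _ _ π stationary _ =
  levelZeroAverage {n} {p} {q} π , λ x xΓ O unique orbit → level x , 0 , orbit-average n p q π stationary x xΓ O unique orbit
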